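{- There is an absolute constant $c>0$ such that for all integers $m,n\ge2$ and every sortable $m\times n$ instance $A$ of the Torus Puzzle in which every column is body-sorted, there is a sequence of at most $c\cdot mn$ rotations, each a unit rightward rotation of a row or a unit downward rotation of a column, whose application to $A$ yields the sorted configuration.
   Context: An $m\times n$ instance of the Torus Puzzle is an $m\times n$ matrix whose entries are $1,\dots,mn$, each exactly once; rows and columns are numbered from $1$. The sorted configuration has entry $(i-1)n+j$ at row $i$, column $j$; the target position of $x$ is row $\lceil x/n\rceil$, column $((x-1)\bmod n)+1$. A unit rightward rotation of a row moves the element in column $j$ to column $j+1$ for $j<n$ and that in column $n$ to column $1$; a unit downward rotation of a column moves the element in row $i$ to row $i+1$ for $i<m$ and that in row $m$ to row $1$; leftward/upward rotations are their inverses. An instance is sortable if some finite sequence of unit row and column rotations (any directions) transforms it into the sorted configuration. The body of a column consists of its rows $2,\dots,m$; a column is body-sorted if every element in its body is at its target position. -}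

module Defs where

open import Data.Nat using (ℕ; zero; suc; _+_; _*_; _≤_)
open import Data.Fin using (Fin; toℕ; zero; suc; fromℕ; inject₁)
open import Data.Fin.Properties using (_≟_)
open import Data.List using (List; foldl; length)
open import Data.Product using (_×_; _,_; ∃-syntax)
open import Relation.Nullary using (yes; no)
open import Data.Unit using (⊤)
import Data.Unit
open import Relation.Binary.PropositionalEquality using (_≡_)

-- An m × n matrix, rows and columns indexed 0-based by Fin
-- (Fin index i corresponds to the paper's row/column i+1).
Config : ℕ → ℕ → Set
Config m n = Fin m → Fin n → ℕ

-- m × n instance: entries are 1,…,mn, each exactly once
-- (all entries in range, and distinct positions carry distinct entries;
--  since there are mn positions, this says each value occurs exactly once).
IsInstance : (m n : ℕ) → Config m n → Set
IsInstance m n A =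
  ((i : Fin m) (j : Fin n) → (1 ≤ A i j) × (A i j ≤ m * n)) ×
  ((i i' : Fin m) (j j' : Fin n) → A i j ≡ A i' j' → (i ≡ i') × (j ≡ j'))

-- Sorted configuration: paper's entry (i-1)n+j at row i, column j.
sorted : (m n : ℕ) → Config m n
sorted m n i j = toℕ i * n + toℕ j + 1

prev : {k : ℕ} → Fin k → Fin k
prev {suc k} zero    = fromℕ k
prev {suc k} (suc i) = inject₁ i

next : {k : ℕ} → Fin k → Fin k
next {suc zero}    zero    = zero
next {suc (suc k)} zero    = suc zero
next {suc (suc k)} (suc i) with next {suc k} i
... | zero  = zero
... | suc r = suc (suc r)

-- Unit rotations. rotR i: row i one step rightward (column j → j+1, n → 1);
-- rotL i its inverse; rotD j: column j one step downward; rotU j its inverse.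
data Move (m n : ℕ) : Set where
  rotR : Fin m → Move m n
  rotL : Fin m → Move m n
  rotD : Fin n → Move m n
  rotU : Fin n → Move m n

apply : {m n : ℕ} → Move m n → Config m n → Config m n
apply (rotR r) A i j with r ≟ i
... | yes _ = A i (prev j)
... | no  _ = A i j
apply (rotL r) A i j with r ≟ i
... | yes _ = A i (next j)
... | no  _ = A i j
apply (rotD c) A i j with c ≟ j
... | yes _ = A (prev i) j
... | no  _ = A i j
apply (rotU c) A i j with c ≟ j
... | yes _ = A (next i) j
... | no  _ = A i j

applyAll : {m n : ℕ} → List (Move m n) → Config m n → Config m n
applyAll ms A = foldl (λ B mv → apply mv B) A ms

data IsRDMove {m n : ℕ} : Move m n → Set where
  isR : (i : Fin m) → IsRDMove (rotR i)
  isD : (j : Fin n) → IsRDMove (rotD j)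

Sortable : (m n : ℕ) → Config m n → Set
Sortable m n A = ∃[ ms ] ((i : Fin m) (j : Fin n) → applyAll ms A i j ≡ sorted m n i j)

-- target position (0-based) of value x ≥ 1: row ⌊(x-1)/n⌋, column (x-1) mod n.
-- "x is at its target position (i, j)" iff x = i*n + j + 1 = sorted m n i j.
-- body of column j: rows 2..m, i.e. 0-based rows suc i.
BodySorted : (m n : ℕ) → Config m n → Fin n → Set
BodySorted (suc m) n A j = (i : Fin m) → A (suc i) j ≡ sorted (suc m) n (suc i) j
BodySorted zero    n A j = Data.Unit.⊤

module Submission where

open import Defs
open import Data.Bool using (Bool; true; false; not; if_then_else_; _xor_)
open import Data.Bool.Properties using (not-involutive; not-¬; not-distribˡ-xor; not-distribʳ-xor; xor-assoc; xor-same)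
open import Data.Empty using (⊥)
open import Data.Fin using (Fin; toℕ; zero; suc; fromℕ; fromℕ<; inject₁; combine; remQuot; punchOut; _<?_)
import Data.Fin as Fin
open import Data.Fin.Properties
  using (_≟_; all?; ¬∀⟶∃¬; any?; toℕ-fromℕ; toℕ-fromℕ<; fromℕ<-toℕ; toℕ-inject₁; toℕ-injective; toℕ<n;
         inject₁-injective; fromℕ≢inject₁; toℕ-combine; combine-injective; combine-surjective; combine-remQuot;
         remQuot-combine; punchOut-injective; injective⇒≤)
import Data.Fin.Properties as Finₚ
open import Data.Fin.Permutation
  using (Permutation′; permutation; _⟨$⟩ʳ_; _⟨$⟩ˡ_; _∘ₚ_; transpose; inverseˡ; inverseʳ)
import Data.Fin.Permutation.Components as PC
open import Data.List using (List; []; _∷_; _++_; map; filter; replicate; concat; allFin; tabulate; length)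
open import Data.List.Properties
  using (foldl-++; length-++; length-map; length-filter; length-replicate; length-tabulate)
open import Data.List.Membership.Propositional using (_∈_; _∉_)
open import Data.List.Membership.Propositional.Properties
  using (∈-allFin; ∈-++⁻; ∈-++⁺ˡ; ∈-++⁺ʳ; ∈-map⁻; ∈-map⁺; ∈-filter⁻; ∈-filter⁺)
open import Data.List.Relation.Unary.All using (All; []; _∷_)
import Data.List.Relation.Unary.All as All
open import Data.List.Relation.Unary.All.Properties using (++⁺; concat⁺; replicate⁺; all-filter)
open import Data.List.Relation.Unary.Any using (here; there)
open import Data.List.Relation.Unary.Unique.Propositional using (Unique; []; _∷_)
import Data.List.Relation.Unary.Unique.Propositional.Properties as Unique
open import Data.Maybe using (Maybe; just; nothing; maybe; is-just)
import Data.Maybe as Maybe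
open import Data.Maybe.Properties using (just-injective)
open import Data.Nat using (ℕ; zero; suc; _+_; _*_; _∸_; _≤_; _<_; _>_; z≤n; s≤s; _<ᵇ_; NonZero; pred)
open import Data.Nat.Properties hiding (_≟_; _<?_)
import Data.Nat.Properties as ℕ
open import Algebra.Properties.Semiring.Sum ℕ.+-*-semiring
  using (sum; sum-syntax; ∑-distrib-+; *-distribˡ-sum; sum-cong-≗)
open import Data.Nat.Tactic.RingSolver using (solve-∀)
open import Data.Product using (_×_; _,_; ∃-syntax; Σ-syntax; proj₁; proj₂; uncurry)
open import Data.Product.Properties using (×-≡,≡→≡)
open import Data.Sum using (_⊎_; inj₁; inj₂; [_,_]′)
open import Function using (_∘′_; _$_; _|>_)
open import Relation.Binary using (tri<; tri≈; tri>)
open import Relation.Binary.PropositionalEquality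
open import Relation.Nullary using (Dec; yes; no; ¬_; does)
open import Relation.Nullary.Decidable using (dec-true; dec-false)
open import Relation.Nullary.Negation using (contradiction)

private
  variable
    m n : ℕ


prev^ : ℕ → Fin n → Fin n
prev^ zero    j = j
prev^ (suc t) j = prev (prev^ t j)

prev-injective : {i j : Fin n} → prev i ≡ prev j → i ≡ j
prev-injective {suc n} {zero}  {zero}  _ = refl
prev-injective {suc n} {zero}  {suc j} e =
  contradiction (trans (sym (toℕ-fromℕ n)) (trans (cong toℕ e) (toℕ-inject₁ j))) (λ n≡j → <-irrefl (sym n≡j) (toℕ<n j))
prev-injective {suc n} {suc i} {zero}  e =
  contradiction (trans (sym (toℕ-inject₁ i)) (trans (cong toℕ e) (toℕ-fromℕ n))) (λ i≡n → <-irrefl i≡n (toℕ<n i))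
prev-injective {suc n} {suc i} {suc j} e = cong suc (inject₁-injective e)

prev^-injective : (t : ℕ) {i j : Fin n} → prev^ t i ≡ prev^ t j → i ≡ j
prev^-injective zero    e = e
prev^-injective (suc t) e = prev^-injective t (prev-injective e)

prev^-suc : (t : ℕ) (j : Fin n) → prev^ (suc t) j ≡ prev^ t (prev j)
prev^-suc zero    j = refl
prev^-suc (suc t) j = cong prev (prev^-suc t j)

toℕ-prev^ : (t : ℕ) (j : Fin n) → t ≤ toℕ j → toℕ (prev^ t j) + t ≡ toℕ j
toℕ-prev^ zero    j _   = +-identityʳ (toℕ j)
toℕ-prev^ (suc t) j t<j with prev^ t j | toℕ-prev^ t j (≤-trans (n≤1+n t) t<j)
... | zero  | t≡j = contradiction t<j (<-irrefl t≡j)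
... | suc i | e   = trans (cong (_+ suc t) (toℕ-inject₁ i)) (trans (+-suc (toℕ i) t) e)

toℕ-prev^-wrap : (t : ℕ) (j : Fin (suc n)) → toℕ j < t → t ≤ suc n →
                 toℕ (prev^ t j) + t ≡ toℕ j + suc n
toℕ-prev^-wrap {n} (suc t) j j<t t<n with t ≤? toℕ j
... | yes t≤j with prev^ t j | toℕ-prev^ t j t≤j
...   | zero  | t≡j = begin
  toℕ (fromℕ n) + suc t  ≡⟨ cong (_+ suc t) (toℕ-fromℕ n) ⟩
  n + suc t              ≡⟨ +-suc n t ⟩
  suc (n + t)            ≡⟨ cong (λ x → suc (n + x)) t≡j ⟩
  suc (n + toℕ j)        ≡⟨ cong suc (+-comm n (toℕ j)) ⟩
  suc (toℕ j + n)        ≡⟨ +-suc (toℕ j) n ⟨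
  toℕ j + suc n          ∎
  where open ≡-Reasoning
...   | suc i | e = contradiction (≤-trans (s≤s (m≤n+m t (toℕ i))) (≤-trans (≤-reflexive e) (≤-pred j<t))) (<-irrefl refl)
toℕ-prev^-wrap {n} (suc t) j j<t t<n | no t≰j with prev^ t j | toℕ-prev^-wrap t j (≰⇒> t≰j) (≤-trans (n≤1+n t) t<n)
... | zero  | e = contradiction (≤-trans t<n (≤-trans (m≤n+m (suc n) (toℕ j)) (≤-reflexive (sym e)))) (<-irrefl refl)
... | suc i | e = trans (cong (_+ suc t) (toℕ-inject₁ i)) (trans (+-suc (toℕ i) t) e)

prev^-period : (j : Fin n) → prev^ n j ≡ j
prev^-period {suc n} j =
  toℕ-injective (+-cancelʳ-≡ (suc n) _ _ (toℕ-prev^-wrap (suc n) j (toℕ<n j) ≤-refl))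

prev^-onto : (s q : Fin n) → ∃[ t ] (t < n × prev^ t s ≡ q)
prev^-onto {suc n} s q with toℕ q ≤? toℕ s
... | yes q≤s =
  let d , q+d≡s = m≤n⇒∃[o]m+o≡n q≤s
      d≤s = ≤-trans (m≤n+m d (toℕ q)) (≤-reflexive q+d≡s)
  in d , ≤-trans (s≤s d≤s) (toℕ<n s)
       , toℕ-injective (+-cancelʳ-≡ d _ _ (trans (toℕ-prev^ d s d≤s) (sym q+d≡s)))
... | no q≰s =
  let e , 1+q+e≡1+n = m≤n⇒∃[o]m+o≡n (toℕ<n q)
      q+1+e≡1+n = trans (+-suc (toℕ q) e) 1+q+e≡1+n
      t = suc e + toℕ s
      t<1+n = begin-strict
        suc e + toℕ s  <⟨ +-monoʳ-< (suc e) (≰⇒> q≰s) ⟩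
        suc e + toℕ q  ≡⟨ +-comm (suc e) (toℕ q) ⟩
        toℕ q + suc e  ≡⟨ q+1+e≡1+n ⟩
        suc n          ∎
      q+t≡s+1+n = begin-equality
        toℕ q + (suc e + toℕ s)  ≡⟨ +-assoc (toℕ q) (suc e) (toℕ s) ⟨
        toℕ q + suc e + toℕ s    ≡⟨ cong (_+ toℕ s) q+1+e≡1+n ⟩
        suc n + toℕ s            ≡⟨ +-comm (suc n) (toℕ s) ⟩
        toℕ s + suc n            ∎
      s<t = s≤s (m≤n+m (toℕ s) e)
  in t , t<1+n
       , toℕ-injective (+-cancelʳ-≡ t _ _ (trans (toℕ-prev^-wrap t s s<t (<⇒≤ t<1+n)) (sym q+t≡s+1+n)))
  where open ≤-Reasoning

applyAll-++ : (xs ys : List (Move m n)) (C : Config m n) →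
              applyAll (xs ++ ys) C ≡ applyAll ys (applyAll xs C)
applyAll-++ xs ys C = foldl-++ (λ B mv → apply mv B) C xs ys

module _ (C : Config m n) where

  rotR-self : (i : Fin m) (j : Fin n) → apply (rotR i) C i j ≡ C i (prev j)
  rotR-self i j with i ≟ i
  ... | yes _   = refl
  ... | no i≢i = contradiction refl i≢i

  rotR-other : (r i : Fin m) (j : Fin n) → r ≢ i → apply (rotR r) C i j ≡ C i j
  rotR-other r i j r≢i with r ≟ i
  ... | yes r≡i = contradiction r≡i r≢i
  ... | no _    = refl

  rotD-self : (i : Fin m) (j : Fin n) → apply (rotD j) C i j ≡ C (prev i) j
  rotD-self i j with j ≟ j
  ... | yes _   = refl
  ... | no j≢j = contradiction refl j≢j

  rotD-other : (c : Fin n) (i : Fin m) (j : Fin n) → c ≢ j → apply (rotD c) C i j ≡ C i j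
  rotD-other c i j c≢j with c ≟ j
  ... | yes c≡j = contradiction c≡j c≢j
  ... | no _    = refl

  rotL-self : (i : Fin m) (j : Fin n) → apply (rotL i) C i j ≡ C i (next j)
  rotL-self i j with i ≟ i
  ... | yes _   = refl
  ... | no i≢i = contradiction refl i≢i

  rotL-other : (r i : Fin m) (j : Fin n) → r ≢ i → apply (rotL r) C i j ≡ C i j
  rotL-other r i j r≢i with r ≟ i
  ... | yes r≡i = contradiction r≡i r≢i
  ... | no _    = refl

  rotU-self : (i : Fin m) (j : Fin n) → apply (rotU j) C i j ≡ C (next i) j
  rotU-self i j with j ≟ j
  ... | yes _   = refl
  ... | no j≢j = contradiction refl j≢j

  rotU-other : (c : Fin n) (i : Fin m) (j : Fin n) → c ≢ j → apply (rotU c) C i j ≡ C i j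
  rotU-other c i j c≢j with c ≟ j
  ... | yes c≡j = contradiction c≡j c≢j
  ... | no _    = refl

rotR^-self : (t : ℕ) (C : Config m n) (i : Fin m) (j : Fin n) →
             applyAll (replicate t (rotR i)) C i j ≡ C i (prev^ t j)
rotR^-self zero    C i j = refl
rotR^-self (suc t) C i j = trans (rotR^-self t (apply (rotR i) C) i j) (rotR-self C i (prev^ t j))

rotR^-other : (t : ℕ) (C : Config m n) (r i : Fin m) (j : Fin n) → r ≢ i →
              applyAll (replicate t (rotR r)) C i j ≡ C i j
rotR^-other zero    C r i j r≢i = refl
rotR^-other (suc t) C r i j r≢i = trans (rotR^-other t (apply (rotR r) C) r i j r≢i) (rotR-other C r i j r≢i)

rotD^-self : (t : ℕ) (C : Config m n) (i : Fin m) (j : Fin n) →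
             applyAll (replicate t (rotD j)) C i j ≡ C (prev^ t i) j
rotD^-self zero    C i j = refl
rotD^-self (suc t) C i j = trans (rotD^-self t (apply (rotD j) C) i j) (rotD-self C (prev^ t i) j)

rotD^-other : (t : ℕ) (C : Config m n) (c : Fin n) (i : Fin m) (j : Fin n) → c ≢ j →
              applyAll (replicate t (rotD c)) C i j ≡ C i j
rotD^-other zero    C c i j c≢j = refl
rotD^-other (suc t) C c i j c≢j = trans (rotD^-other t (apply (rotD c) C) c i j c≢j) (rotD-other C c i j c≢j)

columnMoves : {m n : ℕ} → (Fin n → ℕ) → List (Fin n) → List (Move m n)
columnMoves k []       = []
columnMoves k (c ∷ cs) = replicate (k c) (rotD c) ++ columnMoves k cs

module _ (k : Fin n → ℕ) where

  columnMoves-∉ : (cs : List (Fin n)) (C : Config m n) (i : Fin m) {j : Fin n} → j ∉ cs →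
                  applyAll (columnMoves k cs) C i j ≡ C i j
  columnMoves-∉ []       C i j∉ = refl
  columnMoves-∉ (c ∷ cs) C i {j} j∉ = begin
    applyAll (columnMoves k (c ∷ cs)) C i j
      ≡⟨ cong (λ D → D i j) (applyAll-++ (replicate (k c) (rotD c)) (columnMoves k cs) C) ⟩
    applyAll (columnMoves k cs) (applyAll (replicate (k c) (rotD c)) C) i j
      ≡⟨ columnMoves-∉ cs _ i (j∉ ∘′ there) ⟩
    applyAll (replicate (k c) (rotD c)) C i j
      ≡⟨ rotD^-other (k c) C c i j (λ c≡j → j∉ (here (sym c≡j))) ⟩
    C i j ∎
    where open ≡-Reasoning

  columnMoves-∈ : (cs : List (Fin n)) (C : Config m n) (i : Fin m) {j : Fin n} → Unique cs → j ∈ cs →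
                  applyAll (columnMoves k cs) C i j ≡ C (prev^ (k j) i) j
  columnMoves-∈ (c ∷ cs) C i (c∉cs ∷ _) (here refl) =
    trans (cong (λ D → D i c) (applyAll-++ (replicate (k c) (rotD c)) (columnMoves k cs) C)) $ trans (columnMoves-∉ cs _ i (λ c∈cs → All.lookup c∉cs c∈cs refl)) (rotD^-self (k c) C i c)
  columnMoves-∈ (c ∷ cs) C i {j} (c∉cs ∷ uniq) (there j∈cs) =
    trans (cong (λ D → D i j) (applyAll-++ (replicate (k c) (rotD c)) (columnMoves k cs) C)) $ trans (columnMoves-∈ cs _ i uniq j∈cs)
          (rotD^-other (k c) C c (prev^ (k j) i) j (λ c≡j → All.lookup c∉cs (subst (_∈ cs) (sym c≡j) j∈cs) refl))

  columnMoves-allFin : (C : Config m n) (i : Fin m) (j : Fin n) →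
                       applyAll (columnMoves k (allFin n)) C i j ≡ C (prev^ (k j) i) j
  columnMoves-allFin C i j = columnMoves-∈ (allFin n) C i (Unique.allFin⁺ n) (∈-allFin j)

  columnMoves-RD : {m : ℕ} (cs : List (Fin n)) → All.All IsRDMove (columnMoves {m} k cs)
  columnMoves-RD []       = All.[]
  columnMoves-RD (c ∷ cs) = ++⁺ (replicate⁺ (k c) (isD c)) (columnMoves-RD cs)

  length-columnMoves : {m l : ℕ} (f : Fin l → Fin n) →
                       length (columnMoves {m} k (tabulate f)) ≡ ∑[ i < l ] k (f i)
  length-columnMoves {m} {zero}  f = refl
  length-columnMoves {m} {suc l} f = begin
    length (replicate (k (f zero)) (rotD (f zero)) ++ columnMoves {m} k (tabulate (f ∘′ suc)))
      ≡⟨ length-++ (replicate (k (f zero)) (rotD (f zero))) ⟩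
    length (replicate (k (f zero)) (rotD (f zero))) + length (columnMoves {m} k (tabulate (f ∘′ suc)))
      ≡⟨ cong₂ _+_ (length-replicate (k (f zero))) (length-columnMoves (f ∘′ suc)) ⟩
    k (f zero) + ∑[ i < l ] k (f (suc i)) ∎
    where open ≡-Reasoning

∑-mono-≤ : {n : ℕ} {f g : Fin n → ℕ} → (∀ i → f i ≤ g i) → ∑[ i < n ] f i ≤ ∑[ i < n ] g i
∑-mono-≤ {zero}  f≤g = z≤n
∑-mono-≤ {suc n} f≤g = +-mono-≤ (f≤g zero) (∑-mono-≤ (λ i → f≤g (suc i)))

∑-≤-length : {n : ℕ} {f : Fin n → ℕ} → (∀ i → f i ≤ 1) → ∑[ i < n ] f i ≤ n
∑-≤-length {zero}  f≤1 = z≤n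
∑-≤-length {suc n} f≤1 = +-mono-≤ (f≤1 zero) (∑-≤-length (λ i → f≤1 (suc i)))

module Registers (k : ℕ) {n : ℕ} where

  bodyWith : ℕ → Fin n → Fin (suc k) → ℕ
  bodyWith s j x with x ≟ fromℕ k
  ... | yes _ = s
  ... | no _  = sorted (2 + k) n (suc x) j

  bodyWith-bottom : (s : ℕ) (j : Fin n) → bodyWith s j (fromℕ k) ≡ s
  bodyWith-bottom s j with fromℕ k ≟ fromℕ k
  ... | yes _ = refl
  ... | no ≢ = contradiction refl ≢

  bodyWith-inject₁ : (s : ℕ) (j : Fin n) (y : Fin k) → bodyWith s j (inject₁ y) ≡ sorted (2 + k) n (suc (inject₁ y)) j
  bodyWith-inject₁ s j y with inject₁ y ≟ fromℕ k
  ... | yes e = contradiction (sym e) fromℕ≢inject₁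
  ... | no _  = refl

  shiftIf : Bool → Fin (suc k) → Fin (suc k)
  shiftIf false x = x
  shiftIf true  x = prev x

  swapCost : Bool → ℕ
  swapCost false = 1
  swapCost true  = suc k

  ColumnHolds : Config (2 + k) n → Fin n → ℕ → Bool → Set
  ColumnHolds C j s o = ∀ x → C (suc x) j ≡ bodyWith s j (shiftIf o x)

  Regs : Config (2 + k) n → (Fin n → ℕ) → (Fin n → Bool) → Set
  Regs C S o = ∀ j → ColumnHolds C j (S j) (o j)

  exchange : {C C' : Config (2 + k) n} {j : Fin n} {s : ℕ} (o : Bool) → ColumnHolds C j s o →
             (∀ i → C' i j ≡ C (prev^ (swapCost o) i) j) →
             C' zero j ≡ s × ColumnHolds C' j (C zero j) (not o)
  exchange {C} {C'} {j} {s} false hold rot = top , body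
    where
    top : C' zero j ≡ s
    top = trans (rot zero) (trans (hold (fromℕ k)) (bodyWith-bottom s j))
    body : ColumnHolds C' j (C zero j) true
    body zero    = trans (rot (suc zero)) (sym (bodyWith-bottom (C zero j) j))
    body (suc y) = trans (rot (suc (suc y))) (trans (hold (inject₁ y))
                     (trans (bodyWith-inject₁ s j y) (sym (bodyWith-inject₁ (C zero j) j y))))
  exchange {C} {C'} {j} {s} true hold rot = top , body
    where
    unshift : (i : Fin (2 + k)) → prev (prev^ (suc k) i) ≡ i
    unshift i = prev^-period i
    top′ : (u : Fin (2 + k)) → prev u ≡ zero → C u j ≡ s
    top′ (suc zero) _ = trans (hold zero) (bodyWith-bottom s j)
    body′ : (u : Fin (2 + k)) (x : Fin (suc k)) → prev u ≡ suc x → C u j ≡ bodyWith (C zero j) j x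
    body′ zero          x e = trans (sym (bodyWith-bottom (C zero j) j)) (cong (bodyWith (C zero j) j) (Finₚ.suc-injective e))
    body′ (suc (suc y)) x e = trans (hold (suc y)) (trans (bodyWith-inject₁ s j y)
                                (trans (sym (bodyWith-inject₁ (C zero j) j y)) (cong (bodyWith (C zero j) j) (Finₚ.suc-injective e))))
    top : C' zero j ≡ s
    top = trans (rot zero) (top′ _ (unshift zero))
    body : ColumnHolds C' j (C zero j) false
    body x = trans (rot (suc x)) (body′ _ x (unshift (suc x)))

  exchanged : {A : Set} → (Fin n → Maybe A) → (A → ℕ) → (Fin n → ℕ) → Fin n → ℕ
  exchanged ev T S s = maybe T (S s) (ev s)

  toggle : {A : Set} → (Fin n → Maybe A) → (Fin n → Bool) → Fin n → Bool
  toggle ev o s = is-just (ev s) xor o s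

  PartialInjection : (Fin n → Maybe (Fin n)) → Set
  PartialInjection ev = ∀ {s s′ q} → ev s ≡ just q → ev s′ ≡ just q → s ≡ s′

  -- ev s ≡ just q: during the revolution column s exchanges its register with the top-row
  -- entry that started in column q.  That entry passes over column s after meet s q steps.
  module Revolution (ev : Fin n → Maybe (Fin n)) (o : Fin n → Bool) where

    meet : Fin n → Fin n → ℕ
    meet s q = proj₁ (prev^-onto s q)

    meet<n : (s q : Fin n) → meet s q < n
    meet<n s q = proj₁ (proj₂ (prev^-onto s q))

    prev^-meet : (s q : Fin n) → prev^ (meet s q) s ≡ q
    prev^-meet s q = proj₂ (proj₂ (prev^-onto s q))

    FiresAt : ℕ → Fin n → Set
    FiresAt t s = ∃[ q ] (ev s ≡ just q × meet s q ≡ t)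

    DoneBefore : ℕ → Fin n → Set
    DoneBefore t s = ∃[ q ] (ev s ≡ just q × meet s q < t)

    firesAt? : ∀ t s → Dec (FiresAt t s)
    firesAt? t s with ev s
    ... | nothing = no λ { (_ , () , _) }
    ... | just q with meet s q ℕ.≟ t
    ...   | yes m≡t = yes (q , refl , m≡t)
    ...   | no m≢t  = no λ { (q , refl , m≡t) → m≢t m≡t }

    doneBefore? : ∀ t s → Dec (DoneBefore t s)
    doneBefore? t s with ev s
    ... | nothing = no λ { (_ , () , _) }
    ... | just q with meet s q ℕ.<? t
    ...   | yes m<t = yes (q , refl , m<t)
    ...   | no m≮t  = no λ { (q , refl , m<t) → m≮t m<t }

    stepMoves : ℕ → List (Move (2 + k) n)
    stepMoves t = columnMoves (λ s → if does (firesAt? t s) then swapCost (o s) else 0) (allFin n) ++ rotR zero ∷ []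

    movesFrom : ℕ → ℕ → List (Move (2 + k) n)
    movesFrom t zero    = []
    movesFrom t (suc r) = stepMoves t ++ movesFrom (suc t) r

    moves : List (Move (2 + k) n)
    moves = movesFrom 0 n

    fires⇒slot : ∀ {t s} → FiresAt t s → ev s ≡ just (prev^ t s)
    fires⇒slot {s = s} (q , e , refl) = trans e (cong just (sym (prev^-meet s q)))

    fires⇒¬done : ∀ {t s} → FiresAt t s → ¬ DoneBefore t s
    fires⇒¬done (q , e , m≡t) (q′ , e′ , m<t) with trans (sym e) e′
    ... | refl = <-irrefl m≡t m<t

    fires⇒done : ∀ {t s} → FiresAt t s → DoneBefore (suc t) s
    fires⇒done (q , e , m≡t) = q , e , ≤-reflexive (cong suc m≡t)

    done-stable : ∀ {t s} → ¬ FiresAt t s → does (doneBefore? (suc t) s) ≡ does (doneBefore? t s)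
    done-stable {t} {s} ¬fires with doneBefore? (suc t) s | doneBefore? t s
    ... | yes _              | yes _ = refl
    ... | no _               | no _  = refl
    ... | no ¬d              | yes (q , e , m<t) = contradiction (q , e , ≤-trans m<t (n≤1+n t)) ¬d
    ... | yes (q , e , m<1+t) | no ¬d with m≤n⇒m<n∨m≡n (≤-pred m<1+t)
    ...   | inj₁ m<t = contradiction (q , e , m<t) ¬d
    ...   | inj₂ m≡t = contradiction (q , e , m≡t) ¬fires

    module Run (ev-injective : PartialInjection ev)
               (T₀ S₀ : Fin n → ℕ) where

      registerAt : ℕ → Fin n → ℕ
      registerAt t s = if does (doneBefore? t s) then maybe T₀ (S₀ s) (ev s) else S₀ s

      flagAt : ℕ → Fin n → Bool
      flagAt t s = does (doneBefore? t s) xor o s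

      record Stage (t : ℕ) (C : Config (2 + k) n) : Set where
        field
          regs     : Regs C (registerAt t) (flagAt t)
          top-done : ∀ {s q} j → ev s ≡ just q → meet s q < t → prev^ t j ≡ q → C zero j ≡ S₀ s
          top-idle : ∀ j → (∀ s → ev s ≡ just (prev^ t j) → t ≤ meet s (prev^ t j)) →
                     C zero j ≡ T₀ (prev^ t j)

      registerAt-pending : ∀ {t s} → ¬ DoneBefore t s → registerAt t s ≡ S₀ s
      registerAt-pending {t} {s} ¬d rewrite dec-false (doneBefore? t s) ¬d = refl

      flagAt-pending : ∀ {t s} → ¬ DoneBefore t s → flagAt t s ≡ o s
      flagAt-pending {t} {s} ¬d rewrite dec-false (doneBefore? t s) ¬d = refl

      registerAt-done : ∀ {t s q} → ev s ≡ just q → meet s q < t → registerAt t s ≡ T₀ q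
      registerAt-done {t} {s} e m<t rewrite dec-true (doneBefore? t s) (_ , e , m<t) | e = refl

      flagAt-done : ∀ {t s} → DoneBefore t s → flagAt t s ≡ not (o s)
      flagAt-done {t} {s} d rewrite dec-true (doneBefore? t s) d = refl

      module Step {t : ℕ} {C : Config (2 + k) n} (stage : Stage t C) where
        open Stage stage

        κ : Fin n → ℕ
        κ s = if does (firesAt? t s) then swapCost (o s) else 0

        C′ : Config (2 + k) n
        C′ = applyAll (columnMoves κ (allFin n)) C

        C″ : Config (2 + k) n
        C″ = applyAll (stepMoves t) C

        C″≡ : C″ ≡ apply (rotR zero) C′
        C″≡ = applyAll-++ (columnMoves κ (allFin n)) (rotR zero ∷ []) C

        idle-column : ∀ {s} → ¬ FiresAt t s → ∀ i → C′ i s ≡ C i s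
        idle-column {s} ¬f i rewrite columnMoves-allFin κ C i s | dec-false (firesAt? t s) ¬f = refl

        firing-column : ∀ {s} → FiresAt t s →
                        C′ zero s ≡ S₀ s × ColumnHolds C′ s (registerAt (suc t) s) (flagAt (suc t) s)
        firing-column {s} f@(q , e , m≡t) = top , body
          where
          ¬d = fires⇒¬done f
          rot : ∀ i → C′ i s ≡ C (prev^ (swapCost (o s)) i) s
          rot i rewrite columnMoves-allFin κ C i s | dec-true (firesAt? t s) f = refl
          hold : ColumnHolds C s (S₀ s) (o s)
          hold rewrite sym (registerAt-pending ¬d) | sym (flagAt-pending ¬d) = regs s
          swapped = exchange {C} {C′} (o s) hold rot
          top = proj₁ swapped
          slot : prev^ t s ≡ q
          slot = subst (λ u → prev^ u s ≡ q) m≡t (prev^-meet s q)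
          only-s : ∀ s′ → ev s′ ≡ just (prev^ t s) → t ≤ meet s′ (prev^ t s)
          only-s s′ e′ rewrite ev-injective e′ (fires⇒slot f) | slot = ≤-reflexive (sym m≡t)
          C₀≡ : C zero s ≡ T₀ q
          C₀≡ = trans (top-idle s only-s) (cong T₀ slot)
          body : ColumnHolds C′ s (registerAt (suc t) s) (flagAt (suc t) s)
          body x rewrite registerAt-done e (≤-reflexive (cong suc m≡t)) | flagAt-done (fires⇒done f) =
            trans (proj₂ swapped x) (cong (λ r → bodyWith r s (shiftIf (not (o s)) x)) C₀≡)

        lower : ∀ x s → C″ (suc x) s ≡ C′ (suc x) s
        lower x s rewrite C″≡ = rotR-other C′ zero (suc x) s (λ ())

        upper : ∀ j → C″ zero j ≡ C′ zero (prev j)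
        upper j rewrite C″≡ = rotR-self C′ zero j

        stage′ : Stage (suc t) C″
        stage′ = record { regs = regs′ ; top-done = top-done′ ; top-idle = top-idle′ }
          where
          regs′ : Regs C″ (registerAt (suc t)) (flagAt (suc t))
          regs′ s x with firesAt? t s
          ... | yes f = trans (lower x s) (proj₂ (firing-column f) x)
          ... | no ¬f = begin
            C″ (suc x) s                                            ≡⟨ lower x s ⟩
            C′ (suc x) s                                            ≡⟨ idle-column ¬f (suc x) ⟩
            C (suc x) s                                             ≡⟨ regs s x ⟩
            bodyWith (registerAt t s) s (shiftIf (flagAt t s) x)    ≡⟨ cong (λ b → bodyWith (if b then maybe T₀ (S₀ s) (ev s) else S₀ s) s
                                                                                   (shiftIf (b xor o s) x))
                                                                            (done-stable ¬f) ⟨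
            bodyWith (registerAt (suc t) s) s (shiftIf (flagAt (suc t) s) x) ∎
            where open ≡-Reasoning

          top-done′ : ∀ {s q} j → ev s ≡ just q → meet s q < suc t → prev^ (suc t) j ≡ q → C″ zero j ≡ S₀ s
          top-done′ {s} {q} j e m<1+t slot₁ with m≤n⇒m<n∨m≡n (≤-pred m<1+t)
          ... | inj₂ m≡t = trans (upper j) (subst (λ u → C′ zero u ≡ S₀ s) (sym j≡s) (proj₁ (firing-column (q , e , m≡t))))
            where
            j≡s : prev j ≡ s
            j≡s = prev^-injective t (trans (sym (prev^-suc t j)) (trans slot₁ (sym (subst (λ u → prev^ u s ≡ q) m≡t (prev^-meet s q)))))
          ... | inj₁ m<t = trans (upper j) (trans (idle-column ¬f zero) (top-done (prev j) e m<t slot))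
            where
            slot : prev^ t (prev j) ≡ q
            slot = trans (sym (prev^-suc t j)) slot₁
            ¬f : ¬ FiresAt t (prev j)
            ¬f f′ = fires⇒¬done (subst (FiresAt t) (ev-injective (trans (fires⇒slot f′) (cong just slot)) e) f′) (q , e , m<t)

          top-idle′ : ∀ j → (∀ s → ev s ≡ just (prev^ (suc t) j) → suc t ≤ meet s (prev^ (suc t) j)) →
                      C″ zero j ≡ T₀ (prev^ (suc t) j)
          top-idle′ j later rewrite prev^-suc t j =
            trans (upper j) (trans (idle-column ¬f zero) (top-idle (prev j) (λ s e → ≤-trans (n≤1+n t) (later s e))))
            where
            ¬f : ¬ FiresAt t (prev j)
            ¬f f′@(q′ , e′ , m≡t) = <-irrefl (sym (trans (cong (meet (prev j)) (just-injective (trans (sym (fires⇒slot f′)) e′))) m≡t))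
                                           (later (prev j) (fires⇒slot f′))

      open Step using (stage′)

      stage-run : ∀ r {t C} → Stage t C → Stage (t + r) (applyAll (movesFrom t r) C)
      stage-run zero    {t}     stage = subst (λ u → Stage u _) (sym (+-identityʳ t)) stage
      stage-run (suc r) {t} {C} stage =
        subst₂ Stage (sym (+-suc t r)) (sym (applyAll-++ (stepMoves t) (movesFrom (suc t) r) C))
               (stage-run r (stage′ stage))

      module Final {C : Config (2 + k) n} (stage : Stage n C) where
        open Stage stage

        final-hit : ∀ {s q} → ev s ≡ just q → C zero q ≡ S₀ s
        final-hit {s} {q} e = top-done q e (meet<n s q) (prev^-period q)

        final-idle : ∀ {q} → (∀ s → ev s ≢ just q) → C zero q ≡ T₀ q
        final-idle {q} untouched =
          trans (top-idle q (λ s e → contradiction (trans e (cong just (prev^-period q))) (untouched s)))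
                (cong T₀ (prev^-period q))

        final-regs : Regs C (exchanged ev T₀ S₀) (toggle ev o)
        final-regs s x with ev s in e
        ... | just q  rewrite sym (registerAt-done e (meet<n s q)) | sym (flagAt-done (q , e , meet<n s q)) = regs s x
        ... | nothing = subst₂ (λ r b → C (suc x) s ≡ bodyWith r s (shiftIf b x))
                               (registerAt-pending ¬done) (flagAt-pending ¬done) (regs s x)
          where
          ¬done : ¬ DoneBefore n s
          ¬done (q , e′ , _) with trans (sym e) e′
          ... | ()

      stage₀ : {C : Config (2 + k) n} → (∀ j → C zero j ≡ T₀ j) → Regs C S₀ o → Stage 0 C
      stage₀ {C} top regs = record { regs = regs₀ ; top-done = λ { _ _ () _ } ; top-idle = λ j _ → top j }
        where
        regs₀ : Regs C (registerAt 0) (flagAt 0)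
        regs₀ s x = subst₂ (λ r b → C (suc x) s ≡ bodyWith r s (shiftIf b x))
                           (sym (registerAt-pending ¬done)) (sym (flagAt-pending ¬done)) (regs s x)
          where
          ¬done : ¬ DoneBefore 0 s
          ¬done (_ , _ , ())

    module _ (ev-injective : PartialInjection ev) {S : Fin n → ℕ} {C : Config (2 + k) n} (regs : Regs C S o) where
      open Run ev-injective (C zero) S using (stage₀; stage-run; module Final)
      open Final (stage-run n (stage₀ {C} (λ _ → refl) regs))

      revolution-hit : ∀ {s q} → ev s ≡ just q → applyAll moves C zero q ≡ S s
      revolution-hit = final-hit

      revolution-idle : ∀ {q} → (∀ s → ev s ≢ just q) → applyAll moves C zero q ≡ C zero q
      revolution-idle = final-idle

      revolution-regs : Regs (applyAll moves C) (exchanged ev (C zero) S) (toggle ev o)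
      revolution-regs = final-regs

    stepMoves-RD : ∀ t → All IsRDMove (stepMoves t)
    stepMoves-RD t = ++⁺ (columnMoves-RD _ (allFin n)) (isR zero ∷ [])

    movesFrom-RD : ∀ t r → All IsRDMove (movesFrom t r)
    movesFrom-RD t zero    = []
    movesFrom-RD t (suc r) = ++⁺ (stepMoves-RD t) (movesFrom-RD (suc t) r)

    moves-RD : All IsRDMove moves
    moves-RD = movesFrom-RD 0 n

    -- potential for the cost bound: the number of exchanges still to come
    firing : ℕ → Fin n → ℕ
    firing t s = if does (firesAt? t s) then 1 else 0

    remaining : ℕ → Fin n → ℕ
    remaining t s = if does (doneBefore? t s) then 0 else (if is-just (ev s) then 1 else 0)

    remaining-step : ∀ t s → remaining t s ≡ firing t s + remaining (suc t) s
    remaining-step t s with firesAt? t s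
    ... | yes f@(q , e , _) rewrite dec-false (doneBefore? t s) (fires⇒¬done f)
                                  | dec-true (doneBefore? (suc t) s) (fires⇒done f) | e = refl
    ... | no ¬f rewrite done-stable {t} {s} ¬f = refl

    remaining≤1 : ∀ t s → remaining t s ≤ 1
    remaining≤1 t s with does (doneBefore? t s) | is-just (ev s)
    ... | true  | _     = z≤n
    ... | false | true  = ≤-refl
    ... | false | false = z≤n

    stepCost : ∀ t → length (stepMoves t) ≤ suc k * ∑[ s < n ] firing t s + 1
    stepCost t = begin
      length (stepMoves t)                                        ≡⟨ length-++ (columnMoves κ (allFin n)) ⟩
      length (columnMoves {2 + k} κ (allFin n)) + 1               ≡⟨ cong (_+ 1) (length-columnMoves κ (λ s → s)) ⟩
      ∑[ s < n ] κ s + 1                                          ≤⟨ +-monoˡ-≤ 1 (∑-mono-≤ κ≤) ⟩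
      ∑[ s < n ] (suc k * firing t s) + 1                         ≡⟨ cong (_+ 1) (*-distribˡ-sum (suc k) (firing t)) ⟨
      suc k * ∑[ s < n ] firing t s + 1                           ∎
      where
      open ≤-Reasoning
      κ : Fin n → ℕ
      κ s = if does (firesAt? t s) then swapCost (o s) else 0
      κ≤ : ∀ s → κ s ≤ suc k * firing t s
      κ≤ s with does (firesAt? t s) | o s
      ... | false | _     = z≤n
      ... | true  | false = ≤-trans (s≤s z≤n) (≤-reflexive (sym (*-identityʳ (suc k))))
      ... | true  | true  = ≤-reflexive (sym (*-identityʳ (suc k)))

    movesFrom-length : ∀ r t → length (movesFrom t r) ≤ r + suc k * ∑[ s < n ] remaining t s
    movesFrom-length zero    t = z≤n
    movesFrom-length (suc r) t = begin
      length (stepMoves t ++ movesFrom (suc t) r)                 ≡⟨ length-++ (stepMoves t) ⟩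
      length (stepMoves t) + length (movesFrom (suc t) r)         ≤⟨ +-mono-≤ (stepCost t) (movesFrom-length r (suc t)) ⟩
      (suc k * F + 1) + (r + suc k * R)                           ≡⟨ shuffle (suc k * F) (suc k * R) r ⟩
      suc r + (suc k * F + suc k * R)                             ≡⟨ cong (suc r +_) (*-distribˡ-+ (suc k) F R) ⟨
      suc r + suc k * (F + R)                                     ≡⟨ cong (λ x → suc r + suc k * x) (∑-distrib-+ (firing t) (remaining (suc t))) ⟨
      suc r + suc k * ∑[ s < n ] (firing t s + remaining (suc t) s) ≡⟨ cong (λ x → suc r + suc k * x) (sum-cong-≗ (λ s → remaining-step t s)) ⟨
      suc r + suc k * ∑[ s < n ] remaining t s                    ∎
      where
      open ≤-Reasoning
      F = ∑[ s < n ] firing t s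
      R = ∑[ s < n ] remaining (suc t) s
      shuffle : ∀ a b r → a + 1 + (r + b) ≡ suc r + (a + b)
      shuffle = solve-∀

    moves-length : length moves ≤ (2 + k) * n
    moves-length = ≤-trans (movesFrom-length n 0) (+-monoʳ-≤ n (*-monoʳ-≤ (suc k) (∑-≤-length (remaining≤1 0))))

-- P s ≡ just (x , y): column s transposes the top-row entries of columns x and y.
Pairing : ℕ → Set
Pairing n = Fin n → Maybe (Fin n × Fin n)

record Disjoint {n : ℕ} (P : Pairing n) : Set where
  field
    fst-injective : ∀ {s s′ x y x′ y′} → P s ≡ just (x , y) → P s′ ≡ just (x′ , y′) → x ≡ x′ → s ≡ s′
    snd-injective : ∀ {s s′ x y x′ y′} → P s ≡ just (x , y) → P s′ ≡ just (x′ , y′) → y ≡ y′ → s ≡ s′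
    fst≢snd       : ∀ {s s′ x y x′ y′} → P s ≡ just (x , y) → P s′ ≡ just (x′ , y′) → x ≢ y′

Untouched : {n : ℕ} → Pairing n → Fin n → Set
Untouched P q = ∀ {s x y} → P s ≡ just (x , y) → q ≢ x × q ≢ y

module Batches (k : ℕ) {n : ℕ} where
  open Registers k {n}

  Regs-cong : {C : Config (2 + k) n} {S S′ : Fin n → ℕ} {o o′ : Fin n → Bool} →
              (∀ j → S j ≡ S′ j) → (∀ j → o j ≡ o′ j) → Regs C S o → Regs C S′ o′
  Regs-cong {C} S≗ o≗ regs j x = subst₂ (λ s b → C (suc x) j ≡ bodyWith s j (shiftIf b x)) (S≗ j) (o≗ j) (regs j x)

  module Batch (P : Pairing n) where

    firsts seconds : Fin n → Maybe (Fin n)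
    firsts  s = Maybe.map proj₁ (P s)
    seconds s = Maybe.map proj₂ (P s)

    -- the register of column s picks up the entry of column x, swaps it with that of column y,
    -- and puts it back in column x
    batchMoves : (Fin n → Bool) → List (Move (2 + k) n)
    batchMoves o = Revolution.moves firsts o
                ++ Revolution.moves seconds (toggle firsts o)
                ++ Revolution.moves firsts (toggle seconds (toggle firsts o))

    firsts-just : ∀ {s x y} → P s ≡ just (x , y) → firsts s ≡ just x
    firsts-just e rewrite e = refl

    seconds-just : ∀ {s x y} → P s ≡ just (x , y) → seconds s ≡ just y
    seconds-just e rewrite e = refl

    firsts-inv : ∀ {s x} → firsts s ≡ just x → ∃[ y ] (P s ≡ just (x , y))
    firsts-inv {s} e with P s | e
    ... | just (x , y) | refl = y , refl

    seconds-inv : ∀ {s y} → seconds s ≡ just y → ∃[ x ] (P s ≡ just (x , y))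
    seconds-inv {s} e with P s | e
    ... | just (x , y) | refl = x , refl

    module _ (disjoint : Disjoint P) where
      open Disjoint disjoint

      firsts-injective : PartialInjection firsts
      firsts-injective e e′ with firsts-inv e | firsts-inv e′
      ... | _ , p | _ , p′ = fst-injective p p′ refl

      seconds-injective : PartialInjection seconds
      seconds-injective e e′ with seconds-inv e | seconds-inv e′
      ... | _ , p | _ , p′ = snd-injective p p′ refl

      seconds-miss-firsts : ∀ {s x y} → P s ≡ just (x , y) → ∀ s′ → seconds s′ ≢ just x
      seconds-miss-firsts p s′ e′ with seconds-inv e′
      ... | _ , p′ = fst≢snd p p′ refl

      firsts-miss-seconds : ∀ {s x y} → P s ≡ just (x , y) → ∀ s′ → firsts s′ ≢ just y
      firsts-miss-seconds p s′ e′ with firsts-inv e′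
      ... | _ , p′ = fst≢snd p′ p refl

      firsts-miss : ∀ {q} → Untouched P q → ∀ s → firsts s ≢ just q
      firsts-miss untouched s e with firsts-inv e
      ... | _ , p = proj₁ (untouched p) refl

      seconds-miss : ∀ {q} → Untouched P q → ∀ s → seconds s ≢ just q
      seconds-miss untouched s e with seconds-inv e
      ... | _ , p = proj₂ (untouched p) refl

      module _ {S : Fin n → ℕ} {o : Fin n → Bool} {C : Config (2 + k) n} (regs : Regs C S o) where
        private
          o₁ o₂ : Fin n → Bool
          o₁ = toggle firsts o
          o₂ = toggle seconds o₁
          C₁ C₂ : Config (2 + k) n
          C₁ = applyAll (Revolution.moves firsts o) C
          C₂ = applyAll (Revolution.moves seconds o₁) C₁
          S₁ S₂ : Fin n → ℕ
          S₁ = exchanged firsts (C zero) S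
          S₂ = exchanged seconds (C₁ zero) S₁
          regs₁ : Regs C₁ S₁ o₁
          regs₁ = Revolution.revolution-regs firsts o firsts-injective regs
          regs₂ : Regs C₂ S₂ o₂
          regs₂ = Revolution.revolution-regs seconds o₁ seconds-injective regs₁
          module R₁ = Revolution firsts o
          module R₂ = Revolution seconds o₁
          module R₃ = Revolution firsts o₂

        batch≡ : applyAll (batchMoves o) C ≡ applyAll (Revolution.moves firsts o₂) C₂
        batch≡ = trans (applyAll-++ (R₁.moves) _ C) (applyAll-++ R₂.moves R₃.moves C₁)

        batch-fst : ∀ {s x y} → P s ≡ just (x , y) → applyAll (batchMoves o) C zero x ≡ C zero y
        batch-fst {s} p = begin
          applyAll (batchMoves o) C zero _   ≡⟨ cong (λ D → D zero _) batch≡ ⟩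
          applyAll R₃.moves C₂ zero _        ≡⟨ R₃.revolution-hit firsts-injective regs₂ (firsts-just p) ⟩
          S₂ s                               ≡⟨ cong (maybe (C₁ zero) (S₁ s)) (seconds-just p) ⟩
          C₁ zero _                          ≡⟨ R₁.revolution-idle firsts-injective regs (firsts-miss-seconds p) ⟩
          C zero _                           ∎
          where open ≡-Reasoning

        batch-snd : ∀ {s x y} → P s ≡ just (x , y) → applyAll (batchMoves o) C zero y ≡ C zero x
        batch-snd {s} p = begin
          applyAll (batchMoves o) C zero _   ≡⟨ cong (λ D → D zero _) batch≡ ⟩
          applyAll R₃.moves C₂ zero _        ≡⟨ R₃.revolution-idle firsts-injective regs₂ (firsts-miss-seconds p) ⟩
          C₂ zero _                          ≡⟨ R₂.revolution-hit seconds-injective regs₁ (seconds-just p) ⟩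
          S₁ s                               ≡⟨ cong (maybe (C zero) (S s)) (firsts-just p) ⟩
          C zero _                           ∎
          where open ≡-Reasoning

        batch-idle : ∀ {q} → Untouched P q → applyAll (batchMoves o) C zero q ≡ C zero q
        batch-idle untouched = begin
          applyAll (batchMoves o) C zero _   ≡⟨ cong (λ D → D zero _) batch≡ ⟩
          applyAll R₃.moves C₂ zero _        ≡⟨ R₃.revolution-idle firsts-injective regs₂ (firsts-miss untouched) ⟩
          C₂ zero _                          ≡⟨ R₂.revolution-idle seconds-injective regs₁ (seconds-miss untouched) ⟩
          C₁ zero _                          ≡⟨ R₁.revolution-idle firsts-injective regs (firsts-miss untouched) ⟩
          C zero _                           ∎
          where open ≡-Reasoning

        batch-regs : Regs (applyAll (batchMoves o) C) S (toggle P o)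
        batch-regs rewrite batch≡ = Regs-cong {applyAll R₃.moves C₂} registers flags (R₃.revolution-regs firsts-injective regs₂)
          where
          registers : ∀ s → exchanged firsts (C₂ zero) S₂ s ≡ S s
          registers s with P s in p
          ... | nothing      = refl
          ... | just (x , y) = trans (R₂.revolution-idle seconds-injective regs₁ (seconds-miss-firsts p))
                                     (R₁.revolution-hit firsts-injective regs (firsts-just p))
          flags : ∀ s → toggle firsts o₂ s ≡ toggle P o s
          flags s with P s
          ... | nothing = refl
          ... | just _  = cong not (not-involutive (o s))

    batch-RD : (o : Fin n → Bool) → All IsRDMove (batchMoves o)
    batch-RD o = ++⁺ (Revolution.moves-RD firsts o) (++⁺ (Revolution.moves-RD seconds _) (Revolution.moves-RD firsts _))

    batch-length : (o : Fin n → Bool) → length (batchMoves o) ≤ 3 * ((2 + k) * n)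
    batch-length o = begin
      length (M₁ ++ M₂ ++ M₃)                ≡⟨ length-++ M₁ ⟩
      length M₁ + length (M₂ ++ M₃)          ≡⟨ cong (length M₁ +_) (length-++ M₂) ⟩
      length M₁ + (length M₂ + length M₃)    ≤⟨ +-mono-≤ (R₁.moves-length) (+-mono-≤ R₂.moves-length R₃.moves-length) ⟩
      X + (X + X)                            ≡⟨ cong (λ y → X + (X + y)) (+-identityʳ X) ⟨
      3 * X                                  ∎
      where
      open ≤-Reasoning
      module R₁ = Revolution firsts o
      module R₂ = Revolution seconds (toggle firsts o)
      module R₃ = Revolution firsts (toggle seconds (toggle firsts o))
      M₁ = R₁.moves
      M₂ = R₂.moves
      M₃ = R₃.moves
      X = (2 + k) * n

transpose-fst : (x y : Fin n) → PC.transpose x y x ≡ y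
transpose-fst x y rewrite dec-true (x ≟ x) refl = refl

transpose-snd : (x y : Fin n) → PC.transpose x y y ≡ x
transpose-snd x y with y ≟ x
... | yes y≡x = y≡x
... | no _ rewrite dec-true (y ≟ y) refl = refl

transpose-other : (x y : Fin n) {z : Fin n} → z ≢ x → z ≢ y → PC.transpose x y z ≡ z
transpose-other x y {z} z≢x z≢y rewrite dec-false (z ≟ x) z≢x | dec-false (z ≟ y) z≢y = refl

transpose-comm : (x y z : Fin n) → PC.transpose y x z ≡ PC.transpose x y z
transpose-comm x y z = cases (z ≟ x) (z ≟ y)
  where
  cases : Dec (z ≡ x) → Dec (z ≡ y) → PC.transpose y x z ≡ PC.transpose x y z
  cases (yes refl) (yes refl) = refl
  cases (yes refl) (no _)     = trans (transpose-snd y z) (sym (transpose-fst z y))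
  cases (no _)     (yes refl) = trans (transpose-fst z x) (sym (transpose-snd x z))
  cases (no z≢x)   (no z≢y)   = trans (transpose-other y x z≢y z≢x) (sym (transpose-other x y z≢x z≢y))

transpose-involutive : (x y z : Fin n) → PC.transpose x y (PC.transpose x y z) ≡ z
transpose-involutive x y z = trans (cong (PC.transpose x y) (sym (transpose-comm x y z))) (PC.transpose-inverse x y)

transpose-conj : {m : ℕ} (x y : Fin n) (h : Fin n → Fin m) → (∀ {u v} → h u ≡ h v → u ≡ v) →
                 (z : Fin n) → h (PC.transpose x y z) ≡ PC.transpose (h x) (h y) (h z)
transpose-conj x y h h-inj z = cases (z ≟ x) (z ≟ y)
  where
  cases : Dec (z ≡ x) → Dec (z ≡ y) → h (PC.transpose x y z) ≡ PC.transpose (h x) (h y) (h z)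
  cases (yes refl) _          = trans (cong h (transpose-fst z y)) (sym (transpose-fst (h z) (h y)))
  cases (no _)     (yes refl) = trans (cong h (transpose-snd x z)) (sym (transpose-snd (h x) (h z)))
  cases (no z≢x)   (no z≢y)   = trans (cong h (transpose-other x y z≢x z≢y))
                                      (sym (transpose-other (h x) (h y) (λ e → z≢x (h-inj e)) (λ e → z≢y (h-inj e))))

∑-mono-< : {n : ℕ} {f g : Fin n → ℕ} {x : Fin n} → (∀ i → f i ≤ g i) → f x < g x → ∑[ i < n ] f i < ∑[ i < n ] g i
∑-mono-< {suc n} {x = zero}  f≤g fx<gx = +-mono-<-≤ fx<gx (∑-mono-≤ (λ i → f≤g (suc i)))
∑-mono-< {suc n} {x = suc x} f≤g fx<gx = +-mono-≤-< (f≤g zero) (∑-mono-< (λ i → f≤g (suc i)) fx<gx)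

record Reversal (π : Permutation′ n) (κ : Fin n → Fin n) : Set where
  field
    involutive : ∀ y → κ (κ y) ≡ y
    reverses   : ∀ y → κ (π ⟨$⟩ʳ κ y) ≡ π ⟨$⟩ˡ y
    fixes      : ∀ y → π ⟨$⟩ʳ y ≡ y → κ y ≡ y

  injective : ∀ {u v} → κ u ≡ κ v → u ≡ v
  injective {u} {v} e = trans (sym (involutive u)) (trans (cong κ e) (involutive v))

moved : Permutation′ n → ℕ
moved {n} π = ∑[ y < n ] (if does (π ⟨$⟩ʳ y ≟ y) then 0 else 1)

moved-< : (π π′ : Permutation′ n) {x : Fin n} → (∀ y → π ⟨$⟩ʳ y ≡ y → π′ ⟨$⟩ʳ y ≡ y) →
          π ⟨$⟩ʳ x ≢ x → π′ ⟨$⟩ʳ x ≡ x → moved π′ < moved π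
moved-< π π′ {x} keeps πx≢x π′x≡x = ∑-mono-< pointwise strict
  where
  pointwise : ∀ y → (if does (π′ ⟨$⟩ʳ y ≟ y) then 0 else 1) ≤ (if does (π ⟨$⟩ʳ y ≟ y) then 0 else 1)
  pointwise y with π′ ⟨$⟩ʳ y ≟ y | π ⟨$⟩ʳ y ≟ y
  ... | yes _    | _      = z≤n
  ... | no _     | no _   = ≤-refl
  ... | no π′y≢y | yes πy≡y = contradiction (keeps y πy≡y) π′y≢y
  strict : (if does (π′ ⟨$⟩ʳ x ≟ x) then 0 else 1) < (if does (π ⟨$⟩ʳ x ≟ x) then 0 else 1)
  strict rewrite dec-true (π′ ⟨$⟩ʳ x ≟ x) π′x≡x | dec-false (π ⟨$⟩ʳ x ≟ x) πx≢x = s≤s z≤n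

ReversalThrough : Permutation′ n → Fin n → Set
ReversalThrough π x = ∃[ κ ] (Reversal π κ × κ x ≡ π ⟨$⟩ʳ x)

reversal-id : (π : Permutation′ n) → (∀ y → π ⟨$⟩ʳ y ≡ y) → Reversal π (λ y → y)
reversal-id π all-fixed = record
  { involutive = λ _ → refl
  ; reverses   = λ y → trans (all-fixed y) (sym (trans (cong (π ⟨$⟩ˡ_) (sym (all-fixed y))) (inverseˡ π)))
  ; fixes      = λ _ _ → refl
  }

-- Both steps remove one point from the support (making it a fixed point) and
-- reuse the reversal of the smaller permutation, corrected by a transposition.
module ReversalStep (π : Permutation′ n) (IH : ∀ (π′ : Permutation′ n) → moved π′ < moved π → ∀ x → ReversalThrough π′ x) where

  fixing : (σ : Permutation′ n) → moved σ < moved π → ∀ y → ∃[ κ ] (Reversal σ κ × κ y ≡ y)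
  fixing σ σ<π y with σ ⟨$⟩ʳ y ≟ y
  ... | yes σy≡y = let κ , R , κy = IH σ σ<π y in κ , R , trans κy σy≡y
  ... | no σy≢y = κ , reversal , Reversal.fixes R y σ₂y≡y
    where
    z = σ ⟨$⟩ˡ y
    σz≡y : σ ⟨$⟩ʳ z ≡ y
    σz≡y = inverseʳ σ
    ρ = PC.transpose y z
    σ₂ = transpose y z ∘ₚ σ
    σ₂y≡y : σ₂ ⟨$⟩ʳ y ≡ y
    σ₂y≡y = trans (cong (σ ⟨$⟩ʳ_) (transpose-fst y z)) σz≡y
    keeps : ∀ w → σ ⟨$⟩ʳ w ≡ w → σ₂ ⟨$⟩ʳ w ≡ w
    keeps w σw≡w = trans (cong (σ ⟨$⟩ʳ_) (transpose-other y z w≢y w≢z)) σw≡w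
      where
      w≢y : w ≢ y
      w≢y refl = σy≢y σw≡w
      w≢z : w ≢ z
      w≢z refl = σy≢y (trans (cong (σ ⟨$⟩ʳ_) (sym z≡y)) σz≡y)
        where
        z≡y : z ≡ y
        z≡y = trans (sym σw≡w) σz≡y
    κ-data = IH σ₂ (<-trans (moved-< σ σ₂ keeps σy≢y σ₂y≡y) σ<π) z
    κ = proj₁ κ-data
    R : Reversal σ₂ κ
    R = proj₁ (proj₂ κ-data)
    κz≡σy : κ z ≡ σ ⟨$⟩ʳ y
    κz≡σy = trans (proj₂ (proj₂ κ-data)) (cong (σ ⟨$⟩ʳ_) (transpose-snd y z))
    κy≡y : κ y ≡ y
    κy≡y = Reversal.fixes R y σ₂y≡y
    ρ-conj : ∀ w → ρ (κ w) ≡ κ (PC.transpose y (σ ⟨$⟩ʳ y) w)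
    ρ-conj w = sym (trans (transpose-conj y (σ ⟨$⟩ʳ y) κ (Reversal.injective R) w)
                          (cong₂ (λ a b → PC.transpose a b (κ w)) κy≡y
                                 (trans (cong κ (sym κz≡σy)) (Reversal.involutive R z))))
    σ⁻¹-conj : ∀ w → σ ⟨$⟩ˡ (PC.transpose y (σ ⟨$⟩ʳ y) w) ≡ PC.transpose z y (σ ⟨$⟩ˡ w)
    σ⁻¹-conj w = trans (transpose-conj y (σ ⟨$⟩ʳ y) (σ ⟨$⟩ˡ_) σ⁻¹-injective w)
                       (cong (λ b → PC.transpose z b (σ ⟨$⟩ˡ w)) (inverseˡ σ))
      where
      σ⁻¹-injective : ∀ {u v} → σ ⟨$⟩ˡ u ≡ σ ⟨$⟩ˡ v → u ≡ v
      σ⁻¹-injective {u} {v} e = trans (sym (inverseʳ σ)) (trans (cong (σ ⟨$⟩ʳ_) e) (inverseʳ σ))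
    reversal : Reversal σ κ
    reversal = record
      { involutive = Reversal.involutive R
      ; reverses   = λ w → begin
          κ (σ ⟨$⟩ʳ κ w)                                     ≡⟨ cong (λ v → κ (σ ⟨$⟩ʳ v)) (transpose-involutive y z (κ w)) ⟨
          κ (σ₂ ⟨$⟩ʳ ρ (κ w))                                ≡⟨ cong (λ v → κ (σ₂ ⟨$⟩ʳ v)) (ρ-conj w) ⟩
          κ (σ₂ ⟨$⟩ʳ κ (PC.transpose y (σ ⟨$⟩ʳ y) w))       ≡⟨ Reversal.reverses R _ ⟩
          PC.transpose z y (σ ⟨$⟩ˡ PC.transpose y (σ ⟨$⟩ʳ y) w) ≡⟨ cong (PC.transpose z y) (σ⁻¹-conj w) ⟩
          PC.transpose z y (PC.transpose z y (σ ⟨$⟩ˡ w))     ≡⟨ transpose-involutive z y (σ ⟨$⟩ˡ w) ⟩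
          σ ⟨$⟩ˡ w                                           ∎
      ; fixes      = λ w σw≡w → Reversal.fixes R w (keeps w σw≡w)
      }
      where open ≡-Reasoning

  through : ∀ x → π ⟨$⟩ʳ x ≢ x → ReversalThrough π x
  through x πx≢x = κ , reversal , κx≡y
    where
    y = π ⟨$⟩ʳ x
    τ = PC.transpose x y
    π₁ = π ∘ₚ transpose x y
    π₁x≡x : π₁ ⟨$⟩ʳ x ≡ x
    π₁x≡x = transpose-snd x y
    keeps : ∀ w → π ⟨$⟩ʳ w ≡ w → π₁ ⟨$⟩ʳ w ≡ w
    keeps w πw≡w = trans (cong τ πw≡w) (transpose-other x y w≢x w≢y)
      where
      w≢x : w ≢ x
      w≢x refl = πx≢x πw≡w
      w≢y : w ≢ y
      w≢y refl = πx≢x (trans (sym (inverseˡ π)) (trans (cong (π ⟨$⟩ˡ_) πw≡w) (inverseˡ π)))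
    κ′-data = fixing π₁ (moved-< π π₁ keeps πx≢x π₁x≡x) y
    κ′ = proj₁ κ′-data
    R : Reversal π₁ κ′
    R = proj₁ (proj₂ κ′-data)
    κ′x≡x : κ′ x ≡ x
    κ′x≡x = Reversal.fixes R x π₁x≡x
    commutes : ∀ w → κ′ (τ w) ≡ τ (κ′ w)
    commutes w = trans (transpose-conj x y κ′ (Reversal.injective R) w)
                       (cong₂ (λ a b → PC.transpose a b (κ′ w)) κ′x≡x (proj₂ (proj₂ κ′-data)))
    κ : Fin _ → Fin _
    κ w = τ (κ′ w)
    κx≡y : κ x ≡ y
    κx≡y = trans (cong τ κ′x≡x) (transpose-fst x y)
    reversal : Reversal π κ
    reversal = record
      { involutive = λ w → begin
          τ (κ′ (τ (κ′ w)))   ≡⟨ cong τ (commutes (κ′ w)) ⟩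
          τ (τ (κ′ (κ′ w)))   ≡⟨ transpose-involutive x y _ ⟩
          κ′ (κ′ w)           ≡⟨ Reversal.involutive R w ⟩
          w                   ∎
      ; reverses = λ w → begin
          τ (κ′ (π ⟨$⟩ʳ τ (κ′ w)))        ≡⟨ cong (λ v → τ (κ′ v)) (transpose-involutive x y _) ⟨
          τ (κ′ (τ (π₁ ⟨$⟩ʳ τ (κ′ w))))   ≡⟨ cong τ (commutes _) ⟩
          τ (τ (κ′ (π₁ ⟨$⟩ʳ τ (κ′ w))))   ≡⟨ transpose-involutive x y _ ⟩
          κ′ (π₁ ⟨$⟩ʳ τ (κ′ w))           ≡⟨ cong (λ v → κ′ (π₁ ⟨$⟩ʳ v)) (commutes w) ⟨
          κ′ (π₁ ⟨$⟩ʳ κ′ (τ w))           ≡⟨ Reversal.reverses R (τ w) ⟩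
          π ⟨$⟩ˡ PC.transpose y x (τ w)    ≡⟨ cong (π ⟨$⟩ˡ_) (PC.transpose-inverse y x) ⟩
          π ⟨$⟩ˡ w                         ∎
      ; fixes = λ w πw≡w → trans (cong τ (Reversal.fixes R w (keeps w πw≡w))) (trans (cong τ (sym πw≡w)) (keeps w πw≡w))
      }
      where open ≡-Reasoning

reversal-through : ∀ b (π : Permutation′ n) → moved π < b → ∀ x → ReversalThrough π x
reversal-through {n} (suc b) π π<1+b x = through-or-fixed (π ⟨$⟩ʳ x ≟ x)
  where
  IH : ∀ (π′ : Permutation′ n) → moved π′ < moved π → ∀ x → ReversalThrough π′ x
  IH π′ π′<π = reversal-through b π′ (<-≤-trans π′<π (≤-pred π<1+b))
  through-or-fixed : Dec (π ⟨$⟩ʳ x ≡ x) → ReversalThrough π x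
  through-or-fixed (no πx≢x) = ReversalStep.through π IH x πx≢x
  through-or-fixed (yes πx≡x) with all? (λ y → π ⟨$⟩ʳ y ≟ y)
  ... | yes all-fixed = (λ y → y) , reversal-id π all-fixed , sym πx≡x
  ... | no ¬all-fixed =
    let w , πw≢w = ¬∀⟶∃¬ n _ (λ y → π ⟨$⟩ʳ y ≟ y) ¬all-fixed
        κ , R , _ = ReversalStep.through π IH w πw≢w
    in κ , R , trans (Reversal.fixes R x πx≡x) (sym πx≡x)

reversal : (π : Permutation′ n) → ∃[ κ ] Reversal π κ
reversal {zero}  π = (λ ()) , record { involutive = λ () ; reverses = λ () ; fixes = λ () }
reversal {suc n} π = let κ , R , _ = reversal-through (suc (moved π)) π ≤-refl zero in κ , R

involution-factorisation : (π : Permutation′ n) →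
  Σ[ ι₁ ∈ (Fin n → Fin n) ] Σ[ ι₂ ∈ (Fin n → Fin n) ]
    ((∀ y → ι₁ (ι₁ y) ≡ y) × (∀ y → ι₂ (ι₂ y) ≡ y) × (∀ y → π ⟨$⟩ʳ y ≡ ι₁ (ι₂ y)))
involution-factorisation π =
  let κ , R = reversal π
      open Reversal R
  in (λ y → π ⟨$⟩ʳ κ y) , κ
     , (λ y → trans (cong (π ⟨$⟩ʳ_) (reverses y)) (inverseʳ π))
     , involutive
     , (λ y → cong (π ⟨$⟩ʳ_) (sym (involutive y)))

at : {A : Set} → List A → ℕ → Maybe A
at []       g       = nothing
at (x ∷ xs) zero    = just x
at (x ∷ xs) (suc g) = at xs g

at-∈ : {A : Set} (xs : List A) {g : ℕ} {x : A} → at xs g ≡ just x → x ∈ xs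
at-∈ (y ∷ xs) {zero}  refl = here refl
at-∈ (y ∷ xs) {suc g} e    = there (at-∈ xs e)

∈-at : {A : Set} {xs : List A} {x : A} → x ∈ xs → ∃[ g ] (g < length xs × at xs g ≡ just x)
∈-at (here refl) = zero , s≤s z≤n , refl
∈-at (there x∈xs) = let g , g< , e = ∈-at x∈xs in suc g , s≤s g< , e

at-injective : {A : Set} {xs : List A} {g g′ : ℕ} {x : A} → Unique xs → at xs g ≡ just x → at xs g′ ≡ just x → g ≡ g′
at-injective {xs = y ∷ xs} {zero}  {zero}   _ _ _ = refl
at-injective {xs = y ∷ xs} {zero}  {suc g′} (y∉xs ∷ _) refl e′ = contradiction (at-∈ xs e′) (λ y∈ → All.lookup y∉xs y∈ refl)
at-injective {xs = y ∷ xs} {suc g} {zero}   (y∉xs ∷ _) e refl = contradiction (at-∈ xs e) (λ y∈ → All.lookup y∉xs y∈ refl)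
at-injective {xs = y ∷ xs} {suc g} {suc g′} (_ ∷ uniq) e e′ = cong suc (at-injective uniq e e′)

is-just-at : {A : Set} (xs : List A) (g : ℕ) → is-just (at xs g) ≡ (g <ᵇ length xs)
is-just-at []       g       = refl
is-just-at (x ∷ xs) zero    = refl
is-just-at (x ∷ xs) (suc g) = is-just-at xs g

bit : Bool → ℕ
bit false = 0
bit true  = 1

double : ℕ → ℕ
double zero    = zero
double (suc h) = suc (suc (double h))

-- column s of the schedule takes care of the entries with indices 2s and 2s + 1
entryIndex : {n : ℕ} → Bool → Fin n → ℕ
entryIndex e s = bit e + double (toℕ s)

halve : (g : ℕ) → ∃[ e ] ∃[ h ] (g ≡ bit e + double h)
halve zero          = false , 0 , refl
halve (suc zero)    = true , 0 , refl
halve (suc (suc g)) with halve g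
... | false , h , refl = false , suc h , refl
... | true  , h , refl = true , suc h , refl

halve-unique : ∀ e e′ h h′ → bit e + double h ≡ bit e′ + double h′ → e ≡ e′ × h ≡ h′
halve-unique false false zero     zero     _  = refl , refl
halve-unique true  true  zero     zero     _  = refl , refl
halve-unique false false (suc h)  (suc h′) eq = let e≡ , h≡ = halve-unique false false h h′ (suc-injective (suc-injective eq)) in e≡ , cong suc h≡
halve-unique true  true  (suc h)  (suc h′) eq = let e≡ , h≡ = halve-unique true true h h′ (suc-injective (suc-injective eq)) in e≡ , cong suc h≡
halve-unique false true  zero     zero     ()
halve-unique true  false zero     zero     ()
halve-unique false true  (suc h)  (suc h′) eq with halve-unique false true h h′ (suc-injective (suc-injective eq))
... | () , _
halve-unique true  false (suc h)  (suc h′) eq with halve-unique true false h h′ (suc-injective (suc-injective eq))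
... | () , _
halve-unique false false zero     (suc h′) ()
halve-unique false true  zero     (suc h′) ()
halve-unique true  false zero     (suc h′) ()
halve-unique true  true  zero     (suc h′) ()
halve-unique false false (suc h)  zero     ()
halve-unique false true  (suc h)  zero     ()
halve-unique true  false (suc h)  zero     ()
halve-unique true  true  (suc h)  zero     ()

double-< : ∀ e h n → bit e + double h < double n → h < n
double-< e zero    (suc n) _  = s≤s z≤n
double-< e (suc h) (suc n) lt = s≤s (double-< e h n (≤-pred (≤-pred (subst (_< double (suc n)) (bit-suc-suc e h) lt))))
  where
  bit-suc-suc : ∀ e h → bit e + double (suc h) ≡ suc (suc (bit e + double h))
  bit-suc-suc false h = refl
  bit-suc-suc true  h = refl

both-or-neither : ∀ s h → (double s <ᵇ double h) ≡ (suc (double s) <ᵇ double h)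
both-or-neither zero    zero    = refl
both-or-neither zero    (suc h) = refl
both-or-neither (suc s) zero    = refl
both-or-neither (suc s) (suc h) = both-or-neither s h

module Schedule {n : ℕ} (ι₁ ι₂ : Fin n → Fin n)
                (ι₁-involutive : ∀ y → ι₁ (ι₁ y) ≡ y) (ι₂-involutive : ∀ y → ι₂ (ι₂ y) ≡ y) where

  inv : Bool → Fin n → Fin n
  inv false = ι₁
  inv true  = ι₂

  inv-involutive : ∀ b y → inv b (inv b y) ≡ y
  inv-involutive false = ι₁-involutive
  inv-involutive true  = ι₂-involutive

  inv-injective : ∀ b {u v} → inv b u ≡ inv b v → u ≡ v
  inv-injective b {u} {v} e = trans (sym (inv-involutive b u)) (trans (cong (inv b) e) (inv-involutive b v))

  -- each 2-cycle {x , inv b x} of inv b is represented by its smaller element x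
  leaders : Bool → List (Fin n)
  leaders b = filter (λ x → x <? inv b x) (allFin n)

  tag : Bool → Fin n → Bool × Fin n
  tag b x = b , x

  entries : List (Bool × Fin n)
  entries = map (tag false) (leaders false) ++ map (tag true) (leaders true)

  entries-unique : Unique entries
  entries-unique = Unique.++⁺ (tagged false) (tagged true) disjoint
    where
    tagged : ∀ b → Unique (map (tag b) (leaders b))
    tagged b = Unique.map⁺ (λ e → cong proj₂ e) (Unique.filter⁺ _ (Unique.allFin⁺ n))
    disjoint : ∀ {v} → ¬ (v ∈ map (tag false) (leaders false) × v ∈ map (tag true) (leaders true))
    disjoint (v∈₁ , v∈₂) with ∈-map⁻ (tag false) v∈₁ | ∈-map⁻ (tag true) v∈₂
    ... | _ , _ , refl | _ , _ , ()

  entry⇒leader : ∀ {b x} → (b , x) ∈ entries → x Fin.< inv b x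
  entry⇒leader {b} {x} bx∈ with ∈-++⁻ (map (tag false) (leaders false)) bx∈
  ... | inj₁ bx∈₁ with ∈-map⁻ (tag false) bx∈₁
  ...   | _ , x∈ , refl = proj₂ (∈-filter⁻ (λ x → x <? ι₁ x) {xs = allFin n} x∈)
  entry⇒leader {b} {x} bx∈ | inj₂ bx∈₂ with ∈-map⁻ (tag true) bx∈₂
  ...   | _ , x∈ , refl = proj₂ (∈-filter⁻ (λ x → x <? ι₂ x) {xs = allFin n} x∈)

  leader⇒entry : ∀ b {x} → x Fin.< inv b x → (b , x) ∈ entries
  leader⇒entry false x<ιx = ∈-++⁺ˡ (∈-map⁺ (tag false) (∈-filter⁺ (λ x → x <? ι₁ x) (∈-allFin _) x<ιx))
  leader⇒entry true  x<ιx = ∈-++⁺ʳ (map (tag false) (leaders false)) (∈-map⁺ (tag true) (∈-filter⁺ (λ x → x <? ι₂ x) (∈-allFin _) x<ιx))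

  length-entries : length entries ≤ n + n
  length-entries = begin
    length entries                                       ≡⟨ length-++ (map (tag false) (leaders false)) ⟩
    length (map (tag false) (leaders false)) + length (map (tag true) (leaders true))
                                                         ≡⟨ cong₂ _+_ (length-map _ (leaders false)) (length-map _ (leaders true)) ⟩
    length (leaders false) + length (leaders true)       ≤⟨ +-mono-≤ (bound false) (bound true) ⟩
    n + n                                                ∎
    where
    open ≤-Reasoning
    bound : ∀ b → length (leaders b) ≤ n
    bound b = ≤-trans (length-filter (λ x → x <? inv b x) (allFin n)) (≤-reflexive (length-tabulate (λ x → x)))
      where open Data.Nat.Properties using (≤-reflexive)

  select : Bool → Maybe (Bool × Fin n) → Maybe (Fin n × Fin n)
  select false (just (false , x)) = just (x , ι₁ x)
  select true  (just (true  , x)) = just (x , ι₂ x)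
  select _     _                  = nothing

  select-just : ∀ b m {x y} → select b m ≡ just (x , y) → m ≡ just (b , x) × y ≡ inv b x
  select-just false (just (false , x)) refl = refl , refl
  select-just true  (just (true  , x)) refl = refl , refl
  select-just false nothing            ()
  select-just false (just (true , x))  ()
  select-just true  nothing            ()
  select-just true  (just (false , x)) ()

  select-entry : ∀ b {x} → select b (just (b , x)) ≡ just (x , inv b x)
  select-entry false = refl
  select-entry true  = refl

  select-xor : ∀ m → is-just (select false m) xor is-just (select true m) ≡ is-just m
  select-xor nothing             = refl
  select-xor (just (false , x))  = refl
  select-xor (just (true , x))   = refl

  -- half-batch (b , e): column s swaps the 2-cycle of inv b listed at index entryIndex e s
  opaque
    pairing : Bool → Bool → Pairing n
    pairing b e s = select b (at entries (entryIndex e s))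

    pairing-entry : ∀ {b e s x y} → pairing b e s ≡ just (x , y) →
                    at entries (entryIndex e s) ≡ just (b , x) × y ≡ inv b x
    pairing-entry {b} {e} {s} = select-just b (at entries (entryIndex e s))

    pairing-at : ∀ {b e s x} → at entries (entryIndex e s) ≡ just (b , x) → pairing b e s ≡ just (x , inv b x)
    pairing-at {b} at-g = trans (cong (select b) at-g) (select-entry b)

    pairing-xor : ∀ e s → is-just (pairing false e s) xor is-just (pairing true e s) ≡ is-just (at entries (entryIndex e s))
    pairing-xor e s = select-xor (at entries (entryIndex e s))

  pairing-leader : ∀ {b e s x y} → pairing b e s ≡ just (x , y) → x Fin.< inv b x
  pairing-leader {b} {e} {s} p = entry⇒leader (at-∈ entries (proj₁ (pairing-entry p)))

  pairing-same-entry : ∀ {b e e′ s s′ x y y′} → pairing b e s ≡ just (x , y) → pairing b e′ s′ ≡ just (x , y′) →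
                       e ≡ e′ × s ≡ s′
  pairing-same-entry {b} {e} {e′} {s} {s′} p p′ =
    let e≡e′ , s≡s′ = halve-unique e e′ (toℕ s) (toℕ s′)
                        (at-injective entries-unique (proj₁ (pairing-entry p)) (proj₁ (pairing-entry p′)))
    in e≡e′ , toℕ-injective s≡s′

  same-cycle : ∀ b {x x′ q} → x Fin.< inv b x → x′ Fin.< inv b x′ →
               q ≡ x ⊎ q ≡ inv b x → q ≡ x′ ⊎ q ≡ inv b x′ → x ≡ x′
  same-cycle b x< x′< (inj₁ refl) (inj₁ refl) = refl
  same-cycle b {x} x< x′< (inj₁ refl) (inj₂ x≡ιx′) =
    contradiction (subst (λ z → x Fin.< z) (trans (cong (inv b) x≡ιx′) (inv-involutive b _)) x<) (<-asym (subst (λ z → _ Fin.< z) (sym x≡ιx′) x′<))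
  same-cycle b {x} {x′} x< x′< (inj₂ refl) (inj₁ ιx≡x′) =
    contradiction (subst (λ z → x Fin.< z) ιx≡x′ x<)
                  (<-asym (subst (λ z → x′ Fin.< z) (trans (cong (inv b) (sym ιx≡x′)) (inv-involutive b x)) x′<))
  same-cycle b x< x′< (inj₂ refl) (inj₂ ιx≡ιx′) = inv-injective b ιx≡ιx′

  pairing-disjoint : ∀ b e → Disjoint (pairing b e)
  pairing-disjoint b e = record
    { fst-injective = λ p p′ x≡x′ → fst-injective p p′ x≡x′
    ; snd-injective = λ {s} {s′} p p′ y≡y′ →
        fst-injective p p′ (inv-injective b (trans (sym (proj₂ (pairing-entry p)))
                                             (trans y≡y′ (proj₂ (pairing-entry p′)))))
    ; fst≢snd = λ {s} {s′} p p′ x≡y′ →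
        same-cycle≢ (pairing-leader p) (pairing-leader p′) (trans x≡y′ (proj₂ (pairing-entry p′)))
    }
    where
    fst-injective : ∀ {s s′ x y x′ y′} → pairing b e s ≡ just (x , y) → pairing b e s′ ≡ just (x′ , y′) → x ≡ x′ → s ≡ s′
    fst-injective p p′ refl = proj₂ (pairing-same-entry p p′)
    same-cycle≢ : ∀ {x x′} → x Fin.< inv b x → x′ Fin.< inv b x′ → x ≢ inv b x′
    same-cycle≢ {x} {x′} x< x′< x≡ιx′ with same-cycle b x< x′< (inj₁ refl) (inj₂ x≡ιx′)
    ... | refl = <-irrefl (cong toℕ x≡ιx′) x′<

  pairing-covers : ∀ b {x} → x Fin.< inv b x → ∃[ e ] ∃[ s ] (pairing b e s ≡ just (x , inv b x))
  pairing-covers b {x} x< =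
    let g , g<len , at-g = ∈-at (leader⇒entry b x<)
        e , h , g≡ = halve g
        h<n = double-< e h n (subst₂ _<_ g≡ (double≡+ n) (≤-trans g<len length-entries))
        s = fromℕ< h<n
        index≡ : entryIndex e s ≡ g
        index≡ = trans (cong (λ t → bit e + double t) (toℕ-fromℕ< h<n)) (sym g≡)
    in e , s , pairing-at (trans (cong (at entries) index≡) at-g)
    where
    double≡+ : ∀ m → m + m ≡ double m
    double≡+ zero    = refl
    double≡+ (suc m) = cong suc (trans (+-suc m m) (cong suc (double≡+ m)))

  fixed-untouched : ∀ b e {q} → inv b q ≡ q → Untouched (pairing b e) q
  fixed-untouched b e {q} ιq≡q {s} {x} {y} p = q≢x , q≢y
    where
    x< = pairing-leader p
    y≡ = proj₂ (pairing-entry p)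
    q≢x : q ≢ x
    q≢x refl = <-irrefl (cong toℕ (sym ιq≡q)) x<
    q≢y : q ≢ y
    q≢y q≡y = <-irrefl (cong toℕ (sym ιx≡x)) x<
      where
      ιx≡x : inv b x ≡ x
      ιx≡x = trans (sym (trans q≡y y≡)) (trans (sym ιq≡q) (trans (cong (inv b) (trans q≡y y≡)) (inv-involutive b x)))

  other-untouched : ∀ b e {s x q} → pairing b e s ≡ just (x , inv b x) → q ≡ x ⊎ q ≡ inv b x →
                    Untouched (pairing b (not e)) q
  other-untouched b e {s} {x} {q} p q∈ {s′} {x′} {y′} p′ = q≢x′ , q≢y′
    where
    y′≡ = proj₂ (pairing-entry p′)
    clash : q ≡ x′ ⊎ q ≡ inv b x′ → ⊥
    clash q∈′ with same-cycle b (pairing-leader p) (pairing-leader p′) q∈ q∈′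
    ... | refl = not-¬ refl (proj₁ (pairing-same-entry p (subst (λ y → pairing b (not e) s′ ≡ just (x , y)) y′≡ p′)))
    q≢x′ : q ≢ x′
    q≢x′ q≡x′ = clash (inj₁ q≡x′)
    q≢y′ : q ≢ y′
    q≢y′ q≡y′ = clash (inj₂ (trans q≡y′ y′≡))


  entries-paired : ∀ {h} → length entries ≡ double h → (s : Fin n) →
                   is-just (at entries (entryIndex false s)) ≡ is-just (at entries (entryIndex true s))
  entries-paired {h} len s rewrite is-just-at entries (entryIndex false s) | is-just-at entries (entryIndex true s) | len =
    both-or-neither (toℕ s) h

flags-cancel : ∀ a b c d → a xor c ≡ b xor d → d xor (c xor (b xor (a xor false))) ≡ false
flags-cancel false false false false _ = refl
flags-cancel false false true  true  _ = refl
flags-cancel false true  false true  _ = refl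
flags-cancel false true  true  false _ = refl
flags-cancel true  false false true  _ = refl
flags-cancel true  false true  false _ = refl
flags-cancel true  true  false false _ = refl
flags-cancel true  true  true  true  _ = refl
flags-cancel false false false true  ()
flags-cancel false false true  false ()
flags-cancel false true  false false ()
flags-cancel false true  true  true  ()
flags-cancel true  false false false ()
flags-cancel true  false true  true  ()
flags-cancel true  true  false true  ()
flags-cancel true  true  true  false ()

module Sorting (k : ℕ) {n : ℕ} (ι₁ ι₂ : Fin n → Fin n)
               (ι₁-involutive : ∀ y → ι₁ (ι₁ y) ≡ y) (ι₂-involutive : ∀ y → ι₂ (ι₂ y) ≡ y) where
  open Registers k {n}
  open Batches k {n}
  open Schedule ι₁ ι₂ ι₁-involutive ι₂-involutive

  cycle-leader : ∀ b q → inv b q ≢ q → ∃[ x ] (x Fin.< inv b x × (q ≡ x ⊎ q ≡ inv b x))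
  cycle-leader b q ιq≢q with Finₚ.<-cmp q (inv b q)
  ... | tri< q<ιq _ _ = q , q<ιq , inj₁ refl
  ... | tri≈ _ q≡ιq _ = contradiction (sym q≡ιq) ιq≢q
  ... | tri> _ _ ιq<q = inv b q , subst (inv b q Fin.<_) (sym (inv-involutive b q)) ιq<q , inj₂ (sym (inv-involutive b q))

  swapped : ∀ b e {S o} {D : Config (2 + k) n} → Regs D S o → ∀ {s x q} →
            pairing b e s ≡ just (x , inv b x) → q ≡ x ⊎ q ≡ inv b x →
            applyAll (Batch.batchMoves (pairing b e) o) D zero q ≡ D zero (inv b q)
  swapped b e regs p (inj₁ refl) = Batch.batch-fst (pairing b e) (pairing-disjoint b e) regs p
  swapped b e {D = D} regs {x = x} p (inj₂ refl) =
    trans (Batch.batch-snd (pairing b e) (pairing-disjoint b e) regs p) (cong (D zero) (sym (inv-involutive b x)))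

  module Halves (b : Bool) (o : Fin n → Bool) where
    private
      module B₁ = Batch (pairing b false)
      module B₂ = Batch (pairing b true)

    halvesMoves : List (Move (2 + k) n)
    halvesMoves = B₁.batchMoves o ++ B₂.batchMoves (toggle (pairing b false) o)

    halves-RD : All IsRDMove halvesMoves
    halves-RD = ++⁺ (B₁.batch-RD o) (B₂.batch-RD _)

    halves-length : length halvesMoves ≤ 6 * ((2 + k) * n)
    halves-length = begin
      length halvesMoves                                       ≡⟨ length-++ (B₁.batchMoves o) ⟩
      length (B₁.batchMoves o) + length (B₂.batchMoves _)      ≤⟨ +-mono-≤ (B₁.batch-length o) (B₂.batch-length _) ⟩
      3 * ((2 + k) * n) + 3 * ((2 + k) * n)                    ≡⟨ *-distribʳ-+ ((2 + k) * n) 3 3 ⟨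
      6 * ((2 + k) * n)                                        ∎
      where open ≤-Reasoning

    module _ {S : Fin n → ℕ} {C : Config (2 + k) n} (regs : Regs C S o) where
      private
        C′ = applyAll (B₁.batchMoves o) C
        regs′ : Regs C′ S (toggle (pairing b false) o)
        regs′ = B₁.batch-regs (pairing-disjoint b false) regs
        halves≡ : applyAll halvesMoves C ≡ applyAll (B₂.batchMoves (toggle (pairing b false) o)) C′
        halves≡ = applyAll-++ (B₁.batchMoves o) (B₂.batchMoves (toggle (pairing b false) o)) C

      halves-regs : Regs (applyAll halvesMoves C) S (toggle (pairing b true) (toggle (pairing b false) o))
      halves-regs rewrite halves≡ = B₂.batch-regs (pairing-disjoint b true) regs′

      halves-top : ∀ q → applyAll halvesMoves C zero q ≡ C zero (inv b q)
      halves-top q rewrite halves≡ with inv b q ≟ q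
      ... | yes ιq≡q = begin
        applyAll (B₂.batchMoves _) C′ zero q  ≡⟨ B₂.batch-idle (pairing-disjoint b true) regs′ (fixed-untouched b true ιq≡q) ⟩
        C′ zero q                             ≡⟨ B₁.batch-idle (pairing-disjoint b false) regs (fixed-untouched b false ιq≡q) ⟩
        C zero q                              ≡⟨ cong (C zero) ιq≡q ⟨
        C zero (inv b q)                      ∎
        where open ≡-Reasoning
      ... | no ιq≢q with cycle-leader b q ιq≢q
      ...   | x , x< , q∈ with pairing-covers b x<
      ...     | false , s , p = trans (B₂.batch-idle (pairing-disjoint b true) regs′ (other-untouched b false p q∈))
                                      (swapped b false regs p q∈)
      ...     | true  , s , p = trans (swapped b true regs′ p q∈)
                                      (B₁.batch-idle (pairing-disjoint b false) regs (other-untouched b true p ιq∈))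
        where
        ιq∈ : inv b q ≡ x ⊎ inv b q ≡ inv b x
        ιq∈ = [ (λ q≡x → inj₂ (cong (inv b) q≡x)) , (λ q≡ιx → inj₁ (trans (cong (inv b) q≡ιx) (inv-involutive b x))) ]′ q∈

  bottom : Fin n → ℕ
  bottom j = sorted (2 + k) n (suc (fromℕ k)) j

  bodyWith-bottom-sorted : ∀ j x → bodyWith (bottom j) j x ≡ sorted (2 + k) n (suc x) j
  bodyWith-bottom-sorted j x with x ≟ fromℕ k
  ... | yes refl = refl
  ... | no _     = refl


  flags₀ : Fin n → Bool
  flags₀ _ = false

  flags₂ : Fin n → Bool
  flags₂ = toggle (pairing false true) (toggle (pairing false false) flags₀)

  sortMoves : List (Move (2 + k) n)
  sortMoves = Halves.halvesMoves false flags₀ ++ Halves.halvesMoves true flags₂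

  module _ {h : ℕ} (even : length entries ≡ double h) {C : Config (2 + k) n}
           (body : ∀ x j → C (suc x) j ≡ sorted (2 + k) n (suc x) j) where
    private
      regs₀ : Regs C bottom flags₀
      regs₀ j x = trans (body x j) (sym (bodyWith-bottom-sorted j x))
      C₂ = applyAll (Halves.halvesMoves false flags₀) C
      regs₂ : Regs C₂ bottom flags₂
      regs₂ = Halves.halves-regs false flags₀ regs₀
      sort≡ : applyAll sortMoves C ≡ applyAll (Halves.halvesMoves true flags₂) C₂
      sort≡ = applyAll-++ (Halves.halvesMoves false flags₀) _ C

    sort-top : ∀ q → applyAll sortMoves C zero q ≡ C zero (ι₁ (ι₂ q))
    sort-top q rewrite sort≡ = trans (Halves.halves-top true flags₂ regs₂ q) (Halves.halves-top false flags₀ regs₀ (ι₂ q))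

    sort-body : ∀ x j → applyAll sortMoves C (suc x) j ≡ sorted (2 + k) n (suc x) j
    sort-body x j rewrite sort≡ =
      trans (Halves.halves-regs true flags₂ regs₂ j x) (trans (cong (λ b → bodyWith (bottom j) j (shiftIf b x)) flags-restored)
                                                (bodyWith-bottom-sorted j x))
      where
      flags-restored : toggle (pairing true true) (toggle (pairing true false) flags₂) j ≡ false
      flags-restored = flags-cancel (is-just (pairing false false j)) (is-just (pairing false true j))
                                    (is-just (pairing true false j)) (is-just (pairing true true j)) (trans (pairing-xor false j) (trans (entries-paired even j) (sym (pairing-xor true j))))

  sortMoves-RD : All IsRDMove sortMoves
  sortMoves-RD = ++⁺ (Halves.halves-RD false flags₀) (Halves.halves-RD true flags₂)

  sortMoves-length : length sortMoves ≤ 12 * ((2 + k) * n)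
  sortMoves-length = begin
    length sortMoves                                                    ≡⟨ length-++ (Halves.halvesMoves false flags₀) ⟩
    length (Halves.halvesMoves false flags₀) + length (Halves.halvesMoves true flags₂)
                                                                        ≤⟨ +-mono-≤ (Halves.halves-length false flags₀) (Halves.halves-length true flags₂) ⟩
    6 * ((2 + k) * n) + 6 * ((2 + k) * n)                               ≡⟨ *-distribʳ-+ ((2 + k) * n) 6 6 ⟨
    12 * ((2 + k) * n)                                                  ∎
    where open ≤-Reasoning

sorted-combine : {m n : ℕ} (i : Fin m) (j : Fin n) → sorted m n i j ≡ suc (toℕ (combine i j))
sorted-combine {m} {n} i j = begin
  toℕ i * n + toℕ j + 1     ≡⟨ +-comm (toℕ i * n + toℕ j) 1 ⟩
  suc (toℕ i * n + toℕ j)   ≡⟨ cong (λ x → suc (x + toℕ j)) (*-comm (toℕ i) n) ⟩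
  suc (n * toℕ i + toℕ j)   ≡⟨ cong suc (toℕ-combine i j) ⟨
  suc (toℕ (combine i j))   ∎
  where open ≡-Reasoning

injective⇒onto : {n : ℕ} (f : Fin n → Fin n) → (∀ {u v} → f u ≡ f v → u ≡ v) → ∀ q → ∃[ j ] (f j ≡ q)
injective⇒onto {suc n} f f-injective q with any? (λ j → f j ≟ q)
... | yes found = found
... | no ¬found = contradiction (injective⇒≤ {f = avoid} avoid-injective) (<-irrefl refl)
  where
  -- f misses q, so it factors through Fin n minus q
  avoid : Fin (suc n) → Fin n
  avoid j = punchOut {i = q} {j = f j} (λ q≡fj → ¬found (j , sym q≡fj))
  avoid-injective : ∀ {u v} → avoid u ≡ avoid v → u ≡ v
  avoid-injective {u} {v} e = f-injective (punchOut-injective {i = q} (λ q≡fu → ¬found (u , sym q≡fu)) (λ q≡fv → ¬found (v , sym q≡fv)) e)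

value-cell : {m n : ℕ} (v : ℕ) → 1 ≤ v → v ≤ m * n → ∃[ i ] ∃[ j ] (sorted m n i j ≡ v)
value-cell {m} {n} (suc v) _ v<mn =
  let i , j = remQuot {m} n (fromℕ< v<mn)
  in i , j , trans (sorted-combine i j) (cong suc (trans (cong toℕ (combine-remQuot {m} n (fromℕ< v<mn))) (toℕ-fromℕ< v<mn)))

module TopRow {k n : ℕ} (A : Config (2 + k) n) (inst : IsInstance (2 + k) n A)
              (body : ∀ x j → A (suc x) j ≡ sorted (2 + k) n (suc x) j) where

  private
    in-range = proj₁ inst
    distinct = proj₂ inst

  top≤n : ∀ j → A zero j ≤ n
  top≤n j with A zero j ≤? n
  ... | yes ≤n = ≤n
  ... | no ≰n with value-cell {2 + k} {n} (A zero j) (proj₁ (in-range zero j)) (proj₂ (in-range zero j))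
  ...   | zero  , j′ , e = contradiction (subst (_≤ n) (trans (sym (+-comm (toℕ j′) 1)) e) (toℕ<n j′)) ≰n
  ...   | suc x , j′ , e with distinct (suc x) zero j′ j (trans (body x j′) e)
  ...     | () , _

  private
    index-of : (v : ℕ) → 1 ≤ v → v ≤ n → Fin n
    index-of (suc v) _ v<n = fromℕ< v<n

    index-of-value : ∀ v (1≤v : 1 ≤ v) (v≤n : v ≤ n) → suc (toℕ (index-of v 1≤v v≤n)) ≡ v
    index-of-value (suc v) _ v<n = cong suc (toℕ-fromℕ< v<n)

  position : Fin n → Fin n
  position j = index-of (A zero j) (proj₁ (in-range zero j)) (top≤n j)

  position-value : ∀ j → suc (toℕ (position j)) ≡ A zero j
  position-value j = index-of-value (A zero j) (proj₁ (in-range zero j)) (top≤n j)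

  position-injective : ∀ {u v} → position u ≡ position v → u ≡ v
  position-injective {u} {v} e =
    proj₂ (distinct zero zero u v (trans (sym (position-value u)) (trans (cong (λ z → suc (toℕ z)) e) (position-value v))))

  -- π sends q to the column holding the value q + 1
  top-permutation : Permutation′ n
  top-permutation = permutation holder position
                      (λ j → position-injective (proj₂ (injective⇒onto position position-injective (position j))))
                      (λ q → proj₂ (injective⇒onto position position-injective q))
    where
    holder : Fin n → Fin n
    holder q = proj₁ (injective⇒onto position position-injective q)

  top-permutation-sorts : ∀ q → A zero (top-permutation ⟨$⟩ʳ q) ≡ sorted (2 + k) n zero q
  top-permutation-sorts q = trans (sym (position-value _))
                                  (trans (cong (λ z → suc (toℕ z)) (proj₂ (injective⇒onto position position-injective q)))
                                         (+-comm 1 (toℕ q)))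

parity : ℕ → Bool
parity zero    = false
parity (suc n) = not (parity n)

xor-identityʳ : ∀ x → x xor false ≡ x
xor-identityʳ false = refl
xor-identityʳ true  = refl

parity-+ : ∀ a b → parity (a + b) ≡ parity a xor parity b
parity-+ zero    b = refl
parity-+ (suc a) b = trans (cong not (parity-+ a b)) (not-distribˡ-xor (parity a) (parity b))

sumBelow : ℕ → (ℕ → ℕ) → ℕ
sumBelow zero    f = 0
sumBelow (suc K) f = sumBelow K f + f K

sumBelow-cong : ∀ K {f g : ℕ → ℕ} → (∀ i → i < K → f i ≡ g i) → sumBelow K f ≡ sumBelow K g
sumBelow-cong zero    f≗g = refl
sumBelow-cong (suc K) f≗g = cong₂ _+_ (sumBelow-cong K (λ i i<K → f≗g i (≤-trans i<K (n≤1+n K)))) (f≗g K ≤-refl)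

sumBelow-zero : ∀ K {f : ℕ → ℕ} → (∀ i → i < K → f i ≡ 0) → sumBelow K f ≡ 0
sumBelow-zero K f≡0 = trans (sumBelow-cong K f≡0) (zeros K)
  where
  zeros : ∀ K → sumBelow K (λ _ → 0) ≡ 0
  zeros zero    = refl
  zeros (suc K) = trans (+-comm (sumBelow K (λ _ → 0)) 0) (zeros K)

lt : ℕ → ℕ → ℕ
lt x       zero    = 0
lt zero    (suc y) = 1
lt (suc x) (suc y) = lt x y

lt-flip : ∀ x y → x ≢ y → lt x y + lt y x ≡ 1
lt-flip zero    zero    x≢y = contradiction refl x≢y
lt-flip zero    (suc y) _   = refl
lt-flip (suc x) zero    _   = refl
lt-flip (suc x) (suc y) x≢y = lt-flip x y (λ x≡y → x≢y (cong suc x≡y))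

lt-≥ : ∀ x y → y ≤ x → lt x y ≡ 0
lt-≥ x       zero    _         = refl
lt-≥ (suc x) (suc y) (s≤s y≤x) = lt-≥ x y y≤x

inversions : ℕ → (ℕ → ℕ) → ℕ
inversions K g = sumBelow K (λ j → sumBelow j (λ i → lt (g j) (g i)))

inversions-cong : ∀ K {g h : ℕ → ℕ} → (∀ i → i < K → g i ≡ h i) → inversions K g ≡ inversions K h
inversions-cong K {g} {h} g≗h = sumBelow-cong K λ j j<K →
  trans (sumBelow-cong j (λ i i<j → cong (lt (g j)) (g≗h i (<-trans i<j j<K))))
        (cong (λ x → sumBelow j (λ i → lt x (h i))) (g≗h j j<K))

inversions-monotone : ∀ K (g : ℕ → ℕ) → (∀ i j → i < j → j < K → g i ≤ g j) → inversions K g ≡ 0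
inversions-monotone K g mono = sumBelow-zero K λ j j<K → sumBelow-zero j λ i i<j → lt-≥ (g j) (g i) (mono i j i<j j<K)

lt-< : ∀ x y → x < y → lt x y ≡ 1
lt-< zero    (suc y) _         = refl
lt-< (suc x) (suc y) (s≤s x<y) = lt-< x y x<y

opaque
  swap : ℕ → ℕ → ℕ → ℕ
  swap p q k = if does (k ℕ.≟ p) then q else if does (k ℕ.≟ q) then p else k

  swap-fst : ∀ p q → swap p q p ≡ q
  swap-fst p q rewrite dec-true (p ℕ.≟ p) refl = refl

  swap-snd : ∀ p q → swap p q q ≡ p
  swap-snd p q with q ℕ.≟ p
  ... | yes q≡p rewrite dec-true (q ℕ.≟ p) q≡p = q≡p
  ... | no q≢p rewrite dec-false (q ℕ.≟ p) q≢p | dec-true (q ℕ.≟ q) refl = refl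

  swap-other : ∀ p q {k} → k ≢ p → k ≢ q → swap p q k ≡ k
  swap-other p q {k} k≢p k≢q rewrite dec-false (k ℕ.≟ p) k≢p | dec-false (k ℕ.≟ q) k≢q = refl

data SwapCase (p q k : ℕ) : Set where
  at-fst : k ≡ p → SwapCase p q k
  at-snd : k ≢ p → k ≡ q → SwapCase p q k
  away   : k ≢ p → k ≢ q → SwapCase p q k

swapCase : ∀ p q k → SwapCase p q k
swapCase p q k with k ℕ.≟ p | k ℕ.≟ q
... | yes k≡p | _       = at-fst k≡p
... | no k≢p  | yes k≡q = at-snd k≢p k≡q
... | no k≢p  | no k≢q  = away k≢p k≢q

swap-comm : ∀ p q k → swap p q k ≡ swap q p k
swap-comm p q k with swapCase p q k
... | at-fst refl     = trans (swap-fst k q) (sym (swap-snd q k))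
... | at-snd _ refl   = trans (swap-snd p k) (sym (swap-fst k p))
... | away k≢p k≢q    = trans (swap-other p q k≢p k≢q) (sym (swap-other q p k≢q k≢p))

swap-involutive : ∀ p q k → swap p q (swap p q k) ≡ k
swap-involutive p q k with swapCase p q k
... | at-fst refl   = trans (cong (swap k q) (swap-fst k q)) (swap-snd k q)
... | at-snd _ refl = trans (cong (swap p k) (swap-snd p k)) (swap-fst p k)
... | away k≢p k≢q  = trans (cong (swap p q) (swap-other p q k≢p k≢q)) (swap-other p q k≢p k≢q)

swap-< : ∀ {K} p q k → p < K → q < K → k < K → swap p q k < K
swap-< p q k p<K q<K k<K with swapCase p q k
... | at-fst refl   = subst (_< _) (sym (swap-fst k q)) q<K
... | at-snd _ refl = subst (_< _) (sym (swap-snd p k)) p<K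
... | away k≢p k≢q  = subst (_< _) (sym (swap-other p q k≢p k≢q)) k<K

InjectiveBelow : ℕ → (ℕ → ℕ) → Set
InjectiveBelow K g = ∀ {i j} → i < K → j < K → g i ≡ g j → i ≡ j

flip-by-one : ∀ a b x y → a + x ≡ b + y → x + y ≡ 1 → parity a ≡ not (parity b)
flip-by-one a b zero (suc zero) e _ =
  cong parity (trans (sym (+-identityʳ a)) (trans e (+-comm b 1)))
flip-by-one a b (suc zero) zero e _ =
  trans (sym (not-involutive (parity a))) (cong (not ∘′ parity) (trans (+-comm 1 a) (trans e (+-identityʳ b))))
  where open import Function using (_∘′_)

module Adjacent (g : ℕ → ℕ) (p : ℕ) where
  private
    τ : ℕ → ℕ
    τ = swap p (suc p)
    h : ℕ → ℕ
    h k = g (τ k)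
    τ-below : ∀ i → i < p → τ i ≡ i
    τ-below i i<p = swap-other p (suc p) (λ { refl → <-irrefl refl i<p }) (λ { refl → <-irrefl refl (<-trans (n<1+n p) i<p) })
    τ-above : ∀ i → suc (suc p) ≤ i → τ i ≡ i
    τ-above i p+2≤i = swap-other p (suc p) (λ { refl → <-irrefl refl (<-trans (n<1+n i) p+2≤i) }) (λ { refl → <-irrefl refl p+2≤i })

  sum-swapped : ∀ d (F : ℕ → ℕ) → sumBelow (d + suc (suc p)) (λ i → F (τ i)) ≡ sumBelow (d + suc (suc p)) F
  sum-swapped zero F = begin
    sumBelow p (λ i → F (τ i)) + F (τ p) + F (τ (suc p))
      ≡⟨ cong₂ (λ a b → a + b + F (τ (suc p))) (sumBelow-cong p (λ i i<p → cong F (τ-below i i<p))) (cong F (swap-fst p (suc p))) ⟩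
    sumBelow p F + F (suc p) + F (τ (suc p))
      ≡⟨ cong (λ a → sumBelow p F + F (suc p) + F a) (swap-snd p (suc p)) ⟩
    sumBelow p F + F (suc p) + F p
      ≡⟨ exchange (sumBelow p F) (F (suc p)) (F p) ⟩
    sumBelow p F + F p + F (suc p) ∎
    where
    open ≡-Reasoning
    exchange : ∀ a b c → a + b + c ≡ a + c + b
    exchange = solve-∀
  sum-swapped (suc d) F = cong₂ _+_ (sum-swapped d F) (cong F (τ-above _ (m≤n+m _ d)))

  adjacent : ∀ d → inversions (d + suc (suc p)) h + lt (g (suc p)) (g p) ≡ inversions (d + suc (suc p)) g + lt (g p) (g (suc p))
  adjacent zero = begin
    inversions p h + row₁ + row₀′ + L₁₀                    ≡⟨ cong (λ a → a + row₁ + row₀′ + L₁₀) (inversions-cong p (λ i i<p → cong g (τ-below i i<p))) ⟩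
    I + row₁ + row₀′ + L₁₀                                  ≡⟨ cong (λ a → I + a + row₀′ + L₁₀) row₁≡ ⟩
    I + X₁ + row₀′ + L₁₀                                    ≡⟨ cong (λ a → I + X₁ + a + L₁₀) row₀′≡ ⟩
    I + X₁ + (X₀ + L₀₁) + L₁₀                               ≡⟨ rearrange I X₀ X₁ L₀₁ L₁₀ ⟩
    I + X₀ + (X₁ + L₁₀) + L₀₁                               ∎
    where
    open ≡-Reasoning
    I = inversions p g
    X₀ = sumBelow p (λ i → lt (g p) (g i))
    X₁ = sumBelow p (λ i → lt (g (suc p)) (g i))
    L₀₁ = lt (g p) (g (suc p))
    L₁₀ = lt (g (suc p)) (g p)
    row₁ = sumBelow p (λ i → lt (h p) (h i))
    row₀′ = sumBelow (suc p) (λ i → lt (h (suc p)) (h i))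
    row₁≡ : row₁ ≡ X₁
    row₁≡ = trans (sumBelow-cong p (λ i i<p → cong (lt (h p)) (cong g (τ-below i i<p))))
                  (cong (λ x → sumBelow p (λ i → lt (g x) (g i))) (swap-fst p (suc p)))
    row₀′≡ : row₀′ ≡ X₀ + L₀₁
    row₀′≡ = cong₂ _+_ (trans (sumBelow-cong p (λ i i<p → cong (lt (h (suc p))) (cong g (τ-below i i<p))))
                              (cong (λ x → sumBelow p (λ i → lt (g x) (g i))) (swap-snd p (suc p))))
                       (cong₂ (λ x y → lt (g x) (g y)) (swap-snd p (suc p)) (swap-fst p (suc p)))
    rearrange : ∀ i x₀ x₁ l₀₁ l₁₀ → i + x₁ + (x₀ + l₀₁) + l₁₀ ≡ i + x₀ + (x₁ + l₁₀) + l₀₁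
    rearrange = solve-∀
  adjacent (suc d) = begin
    inversions K h + row h + L₁₀      ≡⟨ cong (λ r → inversions K h + r + L₁₀) row≡ ⟩
    inversions K h + row g + L₁₀      ≡⟨ move (inversions K h) (row g) L₁₀ ⟩
    inversions K h + L₁₀ + row g      ≡⟨ cong (_+ row g) (adjacent d) ⟩
    inversions K g + L₀₁ + row g      ≡⟨ move (inversions K g) L₀₁ (row g) ⟩
    inversions K g + row g + L₀₁      ∎
    where
    open ≡-Reasoning
    K = d + suc (suc p)
    L₀₁ = lt (g p) (g (suc p))
    L₁₀ = lt (g (suc p)) (g p)
    row : (ℕ → ℕ) → ℕ
    row f = sumBelow K (λ i → lt (f K) (f i))
    row≡ : row h ≡ row g
    row≡ = trans (cong (λ x → sumBelow K (λ i → lt (g x) (h i))) (τ-above K (m≤n+m _ d)))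
                 (sum-swapped d (λ i → lt (g K) (g i)))
    move : ∀ a b c → a + b + c ≡ a + c + b
    move = solve-∀

  adjacent-flips : ∀ K → InjectiveBelow K g → suc p < K → parity (inversions K h) ≡ not (parity (inversions K g))
  adjacent-flips K g-injective p+1<K =
    flip-by-one _ _ (lt (g (suc p)) (g p)) (lt (g p) (g (suc p)))
      (subst (λ K → inversions K h + _ ≡ inversions K g + _) (m∸n+n≡m p+1<K) (adjacent (K ∸ suc (suc p))))
      (lt-flip (g (suc p)) (g p) (λ e → <-irrefl (sym (g-injective p+1<K (<-trans (n<1+n p) p+1<K) e)) (n<1+n p)))

swap-conj : ∀ p q k → p < q → swap p (suc q) k ≡ swap q (suc q) (swap p q (swap q (suc q) k))
swap-conj p q k p<q with swapCase p (suc q) k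
... | at-fst refl = begin
  swap k (suc q) k                                     ≡⟨ swap-fst k (suc q) ⟩
  suc q                                                ≡⟨ swap-fst q (suc q) ⟨
  swap q (suc q) q                                     ≡⟨ cong (swap q (suc q)) (swap-fst k q) ⟨
  swap q (suc q) (swap k q k)                          ≡⟨ cong (λ x → swap q (suc q) (swap k q x)) (swap-other q (suc q) k≢q k≢1+q) ⟨
  swap q (suc q) (swap k q (swap q (suc q) k))         ∎
  where
  open ≡-Reasoning
  k≢q : k ≢ q
  k≢q refl = <-irrefl refl p<q
  k≢1+q : k ≢ suc q
  k≢1+q refl = <-irrefl refl (<-trans p<q (n<1+n q))
... | at-snd k≢p refl = begin
  swap p k k                                           ≡⟨ swap-snd p k ⟩
  p                                                    ≡⟨ swap-other q k p≢q p≢k ⟨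
  swap q k p                                           ≡⟨ cong (swap q k) (swap-snd p q) ⟨
  swap q k (swap p q q)                                ≡⟨ cong (λ x → swap q k (swap p q x)) (swap-snd q k) ⟨
  swap q k (swap p q (swap q k k))                     ∎
  where
  open ≡-Reasoning
  p≢q : p ≢ q
  p≢q refl = <-irrefl refl p<q
  p≢k : p ≢ suc q
  p≢k refl = <-irrefl refl (<-trans p<q (n<1+n q))
... | away k≢p k≢1+q with k ℕ.≟ q
...   | yes refl = begin
  swap p (suc k) k                                     ≡⟨ swap-other p (suc k) k≢p k≢1+q ⟩
  k                                                    ≡⟨ swap-snd k (suc k) ⟨
  swap k (suc k) (suc k)                               ≡⟨ cong (swap k (suc k)) (swap-other p k {suc k} (λ { refl → <-irrefl refl (<-trans p<q (n<1+n k)) }) λ ()) ⟨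
  swap k (suc k) (swap p k (suc k))                    ≡⟨ cong (λ x → swap k (suc k) (swap p k x)) (swap-fst k (suc k)) ⟨
  swap k (suc k) (swap p k (swap k (suc k) k))         ∎
  where open ≡-Reasoning
...   | no k≢q = begin
  swap p (suc q) k                                     ≡⟨ swap-other p (suc q) k≢p k≢1+q ⟩
  k                                                    ≡⟨ swap-other q (suc q) k≢q k≢1+q ⟨
  swap q (suc q) k                                     ≡⟨ cong (swap q (suc q)) (swap-other p q k≢p k≢q) ⟨
  swap q (suc q) (swap p q k)                          ≡⟨ cong (λ x → swap q (suc q) (swap p q x)) (swap-other q (suc q) k≢q k≢1+q) ⟨
  swap q (suc q) (swap p q (swap q (suc q) k))         ∎
  where open ≡-Reasoning

injectiveBelow-swap : ∀ {K g} p q → p < K → q < K → InjectiveBelow K g → InjectiveBelow K (λ k → g (swap p q k))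
injectiveBelow-swap p q p<K q<K g-injective {i} {j} i<K j<K e =
  trans (sym (swap-involutive p q i))
        (trans (cong (swap p q) (g-injective (swap-< p q i p<K q<K i<K) (swap-< p q j p<K q<K j<K) e))
               (swap-involutive p q j))

distance : ∀ {p q} → p < q → suc (q ∸ suc p + p) ≡ q
distance {p} {q} p<q = trans (sym (+-suc (q ∸ suc p) p)) (m∸n+n≡m p<q)

-- a transposition at distance suc d is conjugate to one at distance d by an adjacent transposition
private
  swap-flips-< : ∀ d K (g : ℕ → ℕ) p → suc (d + p) < K → InjectiveBelow K g →
                 parity (inversions K (λ k → g (swap p (suc (d + p)) k))) ≡ not (parity (inversions K g))
  swap-flips-< zero    K g p p+1<K g-injective = Adjacent.adjacent-flips g p K g-injective p+1<K
  swap-flips-< (suc d) K g p q+1<K g-injective = begin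
    parity (inversions K (λ k → g (swap p (suc q) k)))  ≡⟨ cong parity (inversions-cong K (λ k _ → cong g (swap-conj p q k p<q))) ⟩
    parity (inversions K (λ k → g₂ (swap q (suc q) k))) ≡⟨ Adjacent.adjacent-flips g₂ q K g₂-injective q+1<K ⟩
    not (parity (inversions K g₂))                      ≡⟨ cong not (swap-flips-< d K g₁ p q<K g₁-injective) ⟩
    not (not (parity (inversions K g₁)))                ≡⟨ not-involutive _ ⟩
    parity (inversions K g₁)                            ≡⟨ Adjacent.adjacent-flips g q K g-injective q+1<K ⟩
    not (parity (inversions K g))                       ∎
    where
    open ≡-Reasoning
    q = suc (d + p)
    q<K = <-trans (n<1+n q) q+1<K
    p<q : p < q
    p<q = s≤s (m≤n+m p d)
    g₁ g₂ : ℕ → ℕ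
    g₁ k = g (swap q (suc q) k)
    g₂ k = g₁ (swap p q k)
    g₁-injective : InjectiveBelow K g₁
    g₁-injective = injectiveBelow-swap q (suc q) q<K q+1<K g-injective
    g₂-injective : InjectiveBelow K g₂
    g₂-injective = injectiveBelow-swap p q (<-trans p<q q<K) q<K g₁-injective

swap-flips : ∀ K (g : ℕ → ℕ) {p q} → p ≢ q → p < K → q < K → InjectiveBelow K g →
             parity (inversions K (λ k → g (swap p q k))) ≡ not (parity (inversions K g))
swap-flips K g {p} {q} p≢q p<K q<K g-injective with <-cmp p q
... | tri≈ _ p≡q _ = contradiction p≡q p≢q
... | tri< p<q _ _ =
  subst (λ r → parity (inversions K (λ k → g (swap p r k))) ≡ not (parity (inversions K g)))
        (distance p<q) (swap-flips-< (q ∸ suc p) K g p (subst (_< K) (sym (distance p<q)) q<K) g-injective)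
... | tri> _ _ q<p =
  trans (cong parity (inversions-cong K (λ k _ → cong g (swap-comm p q k))))
        (subst (λ r → parity (inversions K (λ k → g (swap q r k))) ≡ not (parity (inversions K g)))
               (distance q<p) (swap-flips-< (p ∸ suc q) K g q (subst (_< K) (sym (distance q<p)) p<K) g-injective))

applySwaps : List (ℕ × ℕ) → ℕ → ℕ
applySwaps []             k = k
applySwaps ((p , q) ∷ ts) k = swap p q (applySwaps ts k)

applySwaps-++ : ∀ ts us k → applySwaps (ts ++ us) k ≡ applySwaps ts (applySwaps us k)
applySwaps-++ []             us k = refl
applySwaps-++ ((p , q) ∷ ts) us k = cong (swap p q) (applySwaps-++ ts us k)

ValidSwaps : ℕ → List (ℕ × ℕ) → Set
ValidSwaps K = All (λ (p , q) → p ≢ q × p < K × q < K)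

swaps-parity : ∀ K ts (g : ℕ → ℕ) → ValidSwaps K ts → InjectiveBelow K g →
               parity (inversions K (λ k → g (applySwaps ts k))) ≡ parity (inversions K g) xor parity (length ts)
swaps-parity K []             g []                           _           = sym (xor-identityʳ _)
swaps-parity K ((p , q) ∷ ts) g ((p≢q , p<K , q<K) ∷ valid) g-injective = begin
  parity (inversions K (λ k → g (swap p q (applySwaps ts k))))
    ≡⟨ swaps-parity K ts (λ k → g (swap p q k)) valid (injectiveBelow-swap p q p<K q<K g-injective) ⟩
  parity (inversions K (λ k → g (swap p q k))) xor parity (length ts)
    ≡⟨ cong (_xor parity (length ts)) (swap-flips K g p≢q p<K q<K g-injective) ⟩
  not (parity (inversions K g)) xor parity (length ts)
    ≡⟨ not-distribˡ-xor (parity (inversions K g)) (parity (length ts)) ⟨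
  not (parity (inversions K g) xor parity (length ts))
    ≡⟨ not-distribʳ-xor (parity (inversions K g)) (parity (length ts)) ⟩
  parity (inversions K g) xor not (parity (length ts)) ∎
  where open ≡-Reasoning

cyclePred : ℕ → ℕ → ℕ
cyclePred L zero    = L
cyclePred L (suc x) = x

-- the cyclic shift of the positions base, base + step, …, base + L * step as a product of L swaps
module Progression (base step : ℕ) .{{_ : NonZero step}} where

  pos : ℕ → ℕ
  pos x = base + step * x

  pos-injective : ∀ {x y} → pos x ≡ pos y → x ≡ y
  pos-injective {x} {y} e = *-cancelˡ-≡ x y step (+-cancelˡ-≡ base _ _ e)

  chain : ℕ → List (ℕ × ℕ)
  chain zero    = []
  chain (suc L) = (pos L , pos (suc L)) ∷ chain L

  length-chain : ∀ L → length (chain L) ≡ L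
  length-chain zero    = refl
  length-chain (suc L) = cong suc (length-chain L)

  chain-fixes : ∀ L {k} → (∀ x → x ≤ L → k ≢ pos x) → applySwaps (chain L) k ≡ k
  chain-fixes zero    _     = refl
  chain-fixes (suc L) k≢pos =
    trans (cong (swap (pos L) (pos (suc L))) (chain-fixes L (λ x x≤L → k≢pos x (≤-trans x≤L (n≤1+n L)))))
          (swap-other (pos L) (pos (suc L)) (k≢pos L (n≤1+n L)) (k≢pos (suc L) ≤-refl))

  chain-shifts : ∀ L x → x ≤ L → applySwaps (chain L) (pos x) ≡ pos (cyclePred L x)
  chain-shifts zero    zero    _ = refl
  chain-shifts (suc L) zero    _ = trans (cong (swap (pos L) (pos (suc L))) (chain-shifts L zero z≤n)) (swap-fst (pos L) (pos (suc L)))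
  chain-shifts (suc L) (suc x) (s≤s x≤L) with x ℕ.≟ L
  ... | yes refl = trans (cong (swap (pos x) (pos (suc x))) (chain-fixes x (λ y y≤x e → <-irrefl refl (subst (_≤ x) (sym (pos-injective e)) y≤x))))
                         (swap-snd (pos x) (pos (suc x)))
  ... | no x≢L = trans (cong (swap (pos L) (pos (suc L))) (chain-shifts L (suc x) (≤∧≢⇒< x≤L x≢L)))
                       (swap-other (pos L) (pos (suc L)) (x≢L ∘′ pos-injective) (λ e → <-irrefl refl (subst (_≤ L) (pos-injective e) x≤L)))

  chain-valid : ∀ {K} L → (∀ x → x ≤ L → pos x < K) → ValidSwaps K (chain L)
  chain-valid zero    _      = []
  chain-valid (suc L) pos<K = ((λ e → <-irrefl (pos-injective e) (n<1+n L)) , pos<K L (n≤1+n L) , pos<K (suc L) ≤-refl)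
                             ∷ chain-valid L (λ x x≤L → pos<K x (≤-trans x≤L (n≤1+n L)))

prev-next : {k : ℕ} (x : Fin k) → prev (next x) ≡ x
prev-next {suc zero}    zero    = refl
prev-next {suc (suc k)} zero    = refl
prev-next {suc (suc k)} (suc i) with next i | prev-next i
... | zero  | e = cong suc e
... | suc r | e = cong suc e

next-prev : {k : ℕ} (x : Fin k) → next (prev x) ≡ x
next-prev x = prev-injective (prev-next (prev x))

toℕ-prev : {k : ℕ} (j : Fin (suc k)) → toℕ (prev j) ≡ cyclePred k (toℕ j)
toℕ-prev {k} zero    = toℕ-fromℕ k
toℕ-prev     (suc j) = toℕ-inject₁ j

toℕ≤pred : {k : ℕ} (j : Fin (suc k)) → toℕ j ≤ k
toℕ≤pred j = Data.Nat.Properties.≤-pred (toℕ<n j)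

CellInjective : {m n : ℕ} → Config m n → Set
CellInjective {m} {n} C = (i i′ : Fin m) (j j′ : Fin n) → C i j ≡ C i′ j′ → (i ≡ i′) × (j ≡ j′)

module Linearisation {m n : ℕ} where

  cell : Fin m → Fin n → ℕ
  cell i j = toℕ (combine i j)

  cell-< : ∀ i j → cell i j < m * n
  cell-< i j = toℕ<n (combine i j)

  cell-injective : ∀ i j i′ j′ → cell i j ≡ cell i′ j′ → i ≡ i′ × j ≡ j′
  cell-injective i j i′ j′ e = combine-injective i j i′ j′ (toℕ-injective e)

  cell-onto : ∀ {k} → k < m * n → ∃[ i ] ∃[ j ] (cell i j ≡ k)
  cell-onto k<mn = let i , j , e = combine-surjective (fromℕ< k<mn) in i , j , trans (cong toℕ e) (toℕ-fromℕ< k<mn)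

  cell≡ : ∀ i j → cell i j ≡ n * toℕ i + toℕ j
  cell≡ = toℕ-combine

  -- a configuration read row by row
  lin : Config m n → ℕ → ℕ
  lin C k with k ℕ.<? m * n
  ... | yes k<mn = uncurry C (remQuot n (fromℕ< k<mn))
  ... | no _     = 0

  lin-cell : ∀ C i j → lin C (cell i j) ≡ C i j
  lin-cell C i j with cell i j ℕ.<? m * n
  ... | yes lt = cong (uncurry C) (trans (cong (remQuot n) (fromℕ<-toℕ (combine i j) lt)) (remQuot-combine i j))
  ... | no ≮   = contradiction (cell-< i j) ≮

  by-cells : {f g : ℕ → ℕ} → (∀ i j → f (cell i j) ≡ g (cell i j)) → ∀ k → k < m * n → f k ≡ g k
  by-cells f≗g k k<mn with cell-onto k<mn
  ... | i , j , refl = f≗g i j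

  lin-injective : ∀ {C} → CellInjective C → InjectiveBelow (m * n) (lin C)
  lin-injective {C} C-injective {k} {k′} k< k′< e with cell-onto k< | cell-onto k′<
  ... | i , j , refl | i′ , j′ , refl with C-injective i i′ j j′ (trans (sym (lin-cell C i j)) (trans e (lin-cell C i′ j′)))
  ...   | refl , refl = refl

  sign : Config m n → Bool
  sign C = parity (inversions (m * n) (lin C))

  sign-cong : ∀ {C C′} → (∀ i j → C i j ≡ C′ i j) → sign C ≡ sign C′
  sign-cong {C} {C′} C≗C′ = cong parity (inversions-cong (m * n) {lin C} {lin C′}
    (by-cells {lin C} {lin C′} (λ i j → trans (lin-cell C i j) (trans (C≗C′ i j) (sym (lin-cell C′ i j))))))

  sign-sorted : sign (sorted m n) ≡ false
  sign-sorted = cong parity (inversions-monotone (m * n) (lin (sorted m n)) λ i j i<j j<mn →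
    subst₂ _≤_ (sym (lin-sorted i (<-trans i<j j<mn))) (sym (lin-sorted j j<mn)) (s≤s (Data.Nat.Properties.<⇒≤ i<j)))
    where
    lin-sorted : ∀ k → k < m * n → lin (sorted m n) k ≡ suc k
    lin-sorted = by-cells {lin (sorted m n)} {suc} (λ i j → trans (lin-cell (sorted m n) i j) (sorted-combine i j))

module Moves (m′ n′ : ℕ) where
  open Linearisation {suc m′} {suc n′}

  private
    M N : ℕ
    M = suc m′
    N = suc n′

  rowSwaps : Fin M → List (ℕ × ℕ)
  rowSwaps r = Progression.chain (N * toℕ r) 1 n′

  columnSwaps : Fin N → List (ℕ × ℕ)
  columnSwaps c = Progression.chain (toℕ c) N m′

  row-pos : ∀ r j → Progression.pos (N * toℕ r) 1 (toℕ j) ≡ cell r j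
  row-pos r j = trans (cong (N * toℕ r +_) (*-identityˡ (toℕ j))) (sym (cell≡ r j))

  column-pos : ∀ c i → Progression.pos (toℕ c) N (toℕ i) ≡ cell i c
  column-pos c i = trans (+-comm (toℕ c) (N * toℕ i)) (sym (cell≡ i c))

  rotR-swaps : ∀ C r k → k < M * N → lin (apply (rotR r) C) k ≡ lin C (applySwaps (rowSwaps r) k)
  rotR-swaps C r = by-cells {lin (apply (rotR r) C)} {λ k → lin C (applySwaps (rowSwaps r) k)} on-cell
    where
    open Progression (N * toℕ r) 1
    on-cell : ∀ i j → lin (apply (rotR r) C) (cell i j) ≡ lin C (applySwaps (rowSwaps r) (cell i j))
    on-cell i j with r ≟ i
    ... | yes refl = begin
      lin (apply (rotR r) C) (cell r j)             ≡⟨ lin-cell _ r j ⟩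
      apply (rotR r) C r j                          ≡⟨ rotR-self C r j ⟩
      C r (prev j)                                  ≡⟨ lin-cell C r (prev j) ⟨
      lin C (cell r (prev j))                       ≡⟨ cong (lin C) (row-pos r (prev j)) ⟨
      lin C (pos (toℕ (prev j)))                    ≡⟨ cong (λ x → lin C (pos x)) (toℕ-prev j) ⟩
      lin C (pos (cyclePred n′ (toℕ j)))            ≡⟨ cong (lin C) (chain-shifts n′ (toℕ j) (toℕ≤pred j)) ⟨
      lin C (applySwaps (chain n′) (pos (toℕ j)))   ≡⟨ cong (λ x → lin C (applySwaps (chain n′) x)) (row-pos r j) ⟩
      lin C (applySwaps (chain n′) (cell r j))      ∎
      where open ≡-Reasoning
    ... | no r≢i = begin
      lin (apply (rotR r) C) (cell i j)             ≡⟨ lin-cell _ i j ⟩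
      apply (rotR r) C i j                          ≡⟨ rotR-other C r i j r≢i ⟩
      C i j                                         ≡⟨ lin-cell C i j ⟨
      lin C (cell i j)                              ≡⟨ cong (lin C) (chain-fixes n′ off-row) ⟨
      lin C (applySwaps (chain n′) (cell i j))      ∎
      where
      open ≡-Reasoning
      off-row : ∀ x → x ≤ n′ → cell i j ≢ pos x
      off-row x x≤n′ e = r≢i (sym (proj₁ (cell-injective i j r (fromℕ< (s≤s x≤n′)) (trans e (trans (cong pos (sym (toℕ-fromℕ< (s≤s x≤n′)))) (row-pos r (fromℕ< (s≤s x≤n′))))))))

  rotD-swaps : ∀ C c k → k < M * N → lin (apply (rotD c) C) k ≡ lin C (applySwaps (columnSwaps c) k)
  rotD-swaps C c = by-cells {lin (apply (rotD c) C)} {λ k → lin C (applySwaps (columnSwaps c) k)} on-cell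
    where
    open Progression (toℕ c) N
    on-cell : ∀ i j → lin (apply (rotD c) C) (cell i j) ≡ lin C (applySwaps (columnSwaps c) (cell i j))
    on-cell i j with c ≟ j
    ... | yes refl = begin
      lin (apply (rotD c) C) (cell i c)             ≡⟨ lin-cell _ i c ⟩
      apply (rotD c) C i c                          ≡⟨ rotD-self C i c ⟩
      C (prev i) c                                  ≡⟨ lin-cell C (prev i) c ⟨
      lin C (cell (prev i) c)                       ≡⟨ cong (lin C) (column-pos c (prev i)) ⟨
      lin C (pos (toℕ (prev i)))                    ≡⟨ cong (λ x → lin C (pos x)) (toℕ-prev i) ⟩
      lin C (pos (cyclePred m′ (toℕ i)))            ≡⟨ cong (lin C) (chain-shifts m′ (toℕ i) (toℕ≤pred i)) ⟨
      lin C (applySwaps (chain m′) (pos (toℕ i)))   ≡⟨ cong (λ x → lin C (applySwaps (chain m′) x)) (column-pos c i) ⟩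
      lin C (applySwaps (chain m′) (cell i c))      ∎
      where open ≡-Reasoning
    ... | no c≢j = begin
      lin (apply (rotD c) C) (cell i j)             ≡⟨ lin-cell _ i j ⟩
      apply (rotD c) C i j                          ≡⟨ rotD-other C c i j c≢j ⟩
      C i j                                         ≡⟨ lin-cell C i j ⟨
      lin C (cell i j)                              ≡⟨ cong (lin C) (chain-fixes m′ off-column) ⟨
      lin C (applySwaps (chain m′) (cell i j))      ∎
      where
      open ≡-Reasoning
      off-column : ∀ x → x ≤ m′ → cell i j ≢ pos x
      off-column x x≤m′ e = c≢j (sym (proj₂ (cell-injective i j (fromℕ< (s≤s x≤m′)) c (trans e (trans (cong pos (sym (toℕ-fromℕ< (s≤s x≤m′)))) (column-pos c (fromℕ< (s≤s x≤m′))))))))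

  rowSwaps-valid : ∀ r → ValidSwaps (M * N) (rowSwaps r)
  rowSwaps-valid r = Progression.chain-valid (N * toℕ r) 1 n′ λ x x≤n′ →
    subst (_< M * N) (trans (sym (row-pos r (fromℕ< (s≤s x≤n′)))) (cong (Progression.pos (N * toℕ r) 1) (toℕ-fromℕ< (s≤s x≤n′))))
          (cell-< r (fromℕ< (s≤s x≤n′)))

  columnSwaps-valid : ∀ c → ValidSwaps (M * N) (columnSwaps c)
  columnSwaps-valid c = Progression.chain-valid (toℕ c) N m′ λ x x≤m′ →
    subst (_< M * N) (trans (sym (column-pos c (fromℕ< (s≤s x≤m′)))) (cong (Progression.pos (toℕ c) N) (toℕ-fromℕ< (s≤s x≤m′))))
          (cell-< (fromℕ< (s≤s x≤m′)) c)

  source : Move M N → Fin M → Fin N → Fin M × Fin N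
  source (rotR r) i j with r ≟ i
  ... | yes _ = i , prev j
  ... | no _  = i , j
  source (rotL r) i j with r ≟ i
  ... | yes _ = i , next j
  ... | no _  = i , j
  source (rotD c) i j with c ≟ j
  ... | yes _ = prev i , j
  ... | no _  = i , j
  source (rotU c) i j with c ≟ j
  ... | yes _ = next i , j
  ... | no _  = i , j

  apply-source : ∀ mv C i j → apply mv C i j ≡ uncurry C (source mv i j)
  apply-source (rotR r) C i j with r ≟ i
  ... | yes _ = refl
  ... | no _  = refl
  apply-source (rotL r) C i j with r ≟ i
  ... | yes _ = refl
  ... | no _  = refl
  apply-source (rotD c) C i j with c ≟ j
  ... | yes _ = refl
  ... | no _  = refl
  apply-source (rotU c) C i j with c ≟ j
  ... | yes _ = refl
  ... | no _  = refl

  next-injective : {k : ℕ} {x y : Fin k} → next x ≡ next y → x ≡ y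
  next-injective {x = x} {y} e = trans (sym (prev-next x)) (trans (cong prev e) (prev-next y))

  source-injective : ∀ mv {i j i′ j′} → source mv i j ≡ source mv i′ j′ → i ≡ i′ × j ≡ j′
  source-injective (rotR r) {i} {j} {i′} {j′} e with r ≟ i | r ≟ i′
  ... | yes refl | yes refl = refl , prev-injective (cong proj₂ e)
  ... | yes refl | no r≢i′  = contradiction (cong proj₁ e) r≢i′
  ... | no r≢i   | yes refl = contradiction (sym (cong proj₁ e)) r≢i
  ... | no _     | no _     = cong proj₁ e , cong proj₂ e
  source-injective (rotL r) {i} {j} {i′} {j′} e with r ≟ i | r ≟ i′
  ... | yes refl | yes refl = refl , next-injective (cong proj₂ e)
  ... | yes refl | no r≢i′  = contradiction (cong proj₁ e) r≢i′
  ... | no r≢i   | yes refl = contradiction (sym (cong proj₁ e)) r≢i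
  ... | no _     | no _     = cong proj₁ e , cong proj₂ e
  source-injective (rotD c) {i} {j} {i′} {j′} e with c ≟ j | c ≟ j′
  ... | yes refl | yes refl = prev-injective (cong proj₁ e) , refl
  ... | yes refl | no c≢j′  = contradiction (cong proj₂ e) c≢j′
  ... | no c≢j   | yes refl = contradiction (sym (cong proj₂ e)) c≢j
  ... | no _     | no _     = cong proj₁ e , cong proj₂ e
  source-injective (rotU c) {i} {j} {i′} {j′} e with c ≟ j | c ≟ j′
  ... | yes refl | yes refl = next-injective (cong proj₁ e) , refl
  ... | yes refl | no c≢j′  = contradiction (cong proj₂ e) c≢j′
  ... | no c≢j   | yes refl = contradiction (sym (cong proj₂ e)) c≢j
  ... | no _     | no _     = cong proj₁ e , cong proj₂ e

  apply-injective : ∀ mv {C} → CellInjective C → CellInjective (apply mv C)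
  apply-injective mv {C} C-injective i i′ j j′ e =
    source-injective mv (×-≡,≡→≡ (C-injective _ _ _ _ (trans (sym (apply-source mv C i j)) (trans e (apply-source mv C i′ j′)))))

  rotR-rotL : (C : Config M N) (r i : Fin M) (j : Fin N) → apply (rotR r) (apply (rotL r) C) i j ≡ C i j
  rotR-rotL C r i j = cases (r ≟ i)
    where
    cases : Dec (r ≡ i) → apply (rotR r) (apply (rotL r) C) i j ≡ C i j
    cases (yes refl) = trans (rotR-self (apply (rotL r) C) r j) (trans (rotL-self C r (prev j)) (cong (C r) (next-prev j)))
    cases (no r≢i)   = trans (rotR-other (apply (rotL r) C) r i j r≢i) (rotL-other C r i j r≢i)

  rotD-rotU : (C : Config M N) (c : Fin N) (i : Fin M) (j : Fin N) → apply (rotD c) (apply (rotU c) C) i j ≡ C i j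
  rotD-rotU C c i j = cases (c ≟ j)
    where
    cases : Dec (c ≡ j) → apply (rotD c) (apply (rotU c) C) i j ≡ C i j
    cases (yes refl) = trans (rotD-self (apply (rotU c) C) i c) (trans (rotU-self C (prev i) c) (cong (λ x → C x c) (next-prev i)))
    cases (no c≢j)   = trans (rotD-other (apply (rotU c) C) c i j c≢j) (rotU-other C c i j c≢j)

  moveCost : Move M N → ℕ
  moveCost (rotR _) = n′
  moveCost (rotL _) = n′
  moveCost (rotD _) = m′
  moveCost (rotU _) = m′

  totalCost : List (Move M N) → ℕ
  totalCost []         = 0
  totalCost (mv ∷ ms) = moveCost mv + totalCost ms

  private
    sign-swaps : ∀ {C D} ts → ValidSwaps (M * N) ts → CellInjective C →
                 (∀ k → k < M * N → lin D k ≡ lin C (applySwaps ts k)) → sign D ≡ sign C xor parity (length ts)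
    sign-swaps {C} {D} ts valid C-injective D≗ =
      trans (cong parity (inversions-cong (M * N) {lin D} {λ k → lin C (applySwaps ts k)} D≗))
            (swaps-parity (M * N) ts (lin C) valid (lin-injective C-injective))

    xor-solve : ∀ x y c → x ≡ y xor c → y ≡ x xor c
    xor-solve _ y c refl = sym (trans (xor-assoc y c c) (trans (cong (y xor_) (xor-same c)) (xor-identityʳ y)))

  sign-apply : ∀ mv {C} → CellInjective C → sign (apply mv C) ≡ sign C xor parity (moveCost mv)
  sign-apply (rotR r) {C} C-injective =
    trans (sign-swaps (rowSwaps r) (rowSwaps-valid r) C-injective (rotR-swaps C r))
          (cong (λ l → sign C xor parity l) (Progression.length-chain (N * toℕ r) 1 n′))
  sign-apply (rotD c) {C} C-injective =
    trans (sign-swaps (columnSwaps c) (columnSwaps-valid c) C-injective (rotD-swaps C c))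
          (cong (λ l → sign C xor parity l) (Progression.length-chain (toℕ c) N m′))
  sign-apply (rotL r) {C} C-injective = xor-solve (sign C) (sign (apply (rotL r) C)) (parity n′) (begin
    sign C                                         ≡⟨ sign-cong (rotR-rotL C r) ⟨
    sign (apply (rotR r) (apply (rotL r) C))       ≡⟨ sign-apply (rotR r) (apply-injective (rotL r) C-injective) ⟩
    sign (apply (rotL r) C) xor parity n′          ∎)
    where open ≡-Reasoning
  sign-apply (rotU c) {C} C-injective = xor-solve (sign C) (sign (apply (rotU c) C)) (parity m′) (begin
    sign C                                         ≡⟨ sign-cong (rotD-rotU C c) ⟨
    sign (apply (rotD c) (apply (rotU c) C))       ≡⟨ sign-apply (rotD c) (apply-injective (rotU c) C-injective) ⟩
    sign (apply (rotU c) C) xor parity m′          ∎)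
    where open ≡-Reasoning

  applyAll-injective : ∀ ms {C} → CellInjective C → CellInjective (applyAll ms C)
  applyAll-injective []        C-injective = C-injective
  applyAll-injective (mv ∷ ms) C-injective = applyAll-injective ms (apply-injective mv C-injective)

  sign-applyAll : ∀ ms {C} → CellInjective C → sign (applyAll ms C) ≡ sign C xor parity (totalCost ms)
  sign-applyAll []        {C} _           = sym (xor-identityʳ (sign C))
  sign-applyAll (mv ∷ ms) {C} C-injective = begin
    sign (applyAll ms (apply mv C))                                   ≡⟨ sign-applyAll ms (apply-injective mv C-injective) ⟩
    sign (apply mv C) xor parity (totalCost ms)                       ≡⟨ cong (_xor parity (totalCost ms)) (sign-apply mv C-injective) ⟩
    (sign C xor parity (moveCost mv)) xor parity (totalCost ms)       ≡⟨ xor-assoc (sign C) _ _ ⟩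
    sign C xor (parity (moveCost mv) xor parity (totalCost ms))       ≡⟨ cong (sign C xor_) (parity-+ (moveCost mv) (totalCost ms)) ⟨
    sign C xor parity (moveCost mv + totalCost ms)                    ∎
    where open ≡-Reasoning

  -- with an odd number of rows and of columns every move is an even permutation
  sortable⇒even : parity m′ ≡ false → parity n′ ≡ false → ∀ {A} → CellInjective A → Sortable M N A → sign A ≡ false
  sortable⇒even m′-even n′-even {A} A-injective (ms , sorts) = begin
    sign A                                        ≡⟨ xor-identityʳ (sign A) ⟨
    sign A xor false                              ≡⟨ cong (sign A xor_) (costs-even ms) ⟨
    sign A xor parity (totalCost ms)              ≡⟨ sign-applyAll ms A-injective ⟨
    sign (applyAll ms A)                          ≡⟨ sign-cong sorts ⟩
    sign (sorted M N)                             ≡⟨ sign-sorted ⟩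
    false                                         ∎
    where
    open ≡-Reasoning
    cost-even : ∀ mv → parity (moveCost mv) ≡ false
    cost-even (rotR _) = n′-even
    cost-even (rotL _) = n′-even
    cost-even (rotD _) = m′-even
    cost-even (rotU _) = m′-even
    costs-even : ∀ ms → parity (totalCost ms) ≡ false
    costs-even []        = refl
    costs-even (mv ∷ ms) = trans (parity-+ (moveCost mv) (totalCost ms)) (cong₂ _xor_ (cost-even mv) (costs-even ms))

  apply-instance : ∀ mv {C} → IsInstance M N C → IsInstance M N (apply mv C)
  apply-instance mv {C} (in-range , C-injective) =
    (λ i j → subst (λ v → 1 ≤ v × v ≤ M * N) (sym (apply-source mv C i j)) (in-range _ _)) ,
    apply-injective mv C-injective

  applyAll-instance : ∀ ms {C} → IsInstance M N C → IsInstance M N (applyAll ms C)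
  applyAll-instance []        inst = inst
  applyAll-instance (mv ∷ ms) inst = applyAll-instance ms (apply-instance mv inst)

parity-even : ∀ x → parity x ≡ false → ∃[ h ] (x ≡ double h)
parity-even zero          _ = 0 , refl
parity-even (suc zero)    ()
parity-even (suc (suc x)) e =
  let h , x≡ = parity-even x (trans (sym (not-not (parity x))) e) in suc h , cong (suc ∘′ suc) x≡
  where
  open import Function using (_∘′_)
  not-not : ∀ b → not (not b) ≡ b
  not-not true  = refl
  not-not false = refl

-- as a permutation of the positions 0, …, n - 1, an involution is the product of the
-- transpositions of its 2-cycles
module CycleSwaps {n : ℕ} (ι : Fin n → Fin n) (ι-involutive : ∀ y → ι (ι y) ≡ y) where

  Leader : Fin n → Set
  Leader x = x Fin.< ι x

  swapsOf : List (Fin n) → List (ℕ × ℕ)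
  swapsOf = map (λ x → toℕ x , toℕ (ι x))

  ι-injective : ∀ {x y} → ι x ≡ ι y → x ≡ y
  ι-injective {x} {y} e = trans (sym (ι-involutive x)) (trans (cong ι e) (ι-involutive y))

  toℕ-≢ : ∀ {x y : Fin n} → x ≢ y → toℕ x ≢ toℕ y
  toℕ-≢ x≢y e = x≢y (toℕ-injective e)

  swapsOf-beyond : ∀ xs k → n ≤ k → applySwaps (swapsOf xs) k ≡ k
  swapsOf-beyond []       k n≤k = refl
  swapsOf-beyond (x ∷ xs) k n≤k =
    trans (cong (swap _ _) (swapsOf-beyond xs k n≤k))
          (swap-other _ _ (λ e → <-irrefl (sym e) (<-≤-trans (toℕ<n x) n≤k)) (λ e → <-irrefl (sym e) (<-≤-trans (toℕ<n (ι x)) n≤k)))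

  swapsOf-cycles : ∀ xs → Unique xs → All Leader xs →
    (∀ y → y ∈ xs ⊎ ι y ∈ xs → applySwaps (swapsOf xs) (toℕ y) ≡ toℕ (ι y)) ×
    (∀ y → y ∉ xs → ι y ∉ xs → applySwaps (swapsOf xs) (toℕ y) ≡ toℕ y)
  swapsOf-cycles []       _               _                = (λ { y (inj₁ ()) ; y (inj₂ ()) }) , (λ _ _ _ → refl)
  swapsOf-cycles (x ∷ xs) (x∉xs ∷ unique) (x-leads ∷ leads) = covered , uncovered
    where
    IH = swapsOf-cycles xs unique leads
    σ = swap (toℕ x) (toℕ (ι x))
    x∉ : x ∉ xs
    x∉ x∈ = All.lookup x∉xs x∈ refl
    ιx∉ : ι x ∉ xs
    ιx∉ ιx∈ = <-asym x-leads (subst (λ z → ι x Fin.< z) (ι-involutive x) (All.lookup leads ιx∈))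
    covered : ∀ y → y ∈ x ∷ xs ⊎ ι y ∈ x ∷ xs → applySwaps (swapsOf (x ∷ xs)) (toℕ y) ≡ toℕ (ι y)
    covered y (inj₁ (here refl)) = trans (cong σ (proj₂ IH y x∉ ιx∉)) (swap-fst _ _)
    covered y (inj₂ (here ιy≡x)) =
      trans (cong σ (proj₂ IH y (subst (_∉ xs) (sym y≡ιx) ιx∉) (subst (_∉ xs) (sym ιy≡x) x∉)))
            (trans (cong σ (cong toℕ y≡ιx)) (trans (swap-snd _ _) (cong toℕ (sym ιy≡x))))
      where
      y≡ιx : y ≡ ι x
      y≡ιx = trans (sym (ι-involutive y)) (cong ι ιy≡x)
    covered y (inj₁ (there y∈)) =
      trans (cong σ (proj₁ IH y (inj₁ y∈)))
            (swap-other _ _ (toℕ-≢ λ ιy≡x → ιx∉ (subst (_∈ xs) (trans (sym (ι-involutive y)) (cong ι ιy≡x)) y∈))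
                            (toℕ-≢ λ ιy≡ιx → x∉ (subst (_∈ xs) (ι-injective ιy≡ιx) y∈)))
    covered y (inj₂ (there ιy∈)) =
      trans (cong σ (proj₁ IH y (inj₂ ιy∈)))
            (swap-other _ _ (toℕ-≢ λ ιy≡x → x∉ (subst (_∈ xs) ιy≡x ιy∈)) (toℕ-≢ λ ιy≡ιx → ιx∉ (subst (_∈ xs) ιy≡ιx ιy∈)))
    uncovered : ∀ y → y ∉ x ∷ xs → ι y ∉ x ∷ xs → applySwaps (swapsOf (x ∷ xs)) (toℕ y) ≡ toℕ y
    uncovered y y∉ ιy∉ =
      trans (cong σ (proj₂ IH y (y∉ ∘′ there) (ιy∉ ∘′ there)))
            (swap-other _ _ (toℕ-≢ (y∉ ∘′ here)) (toℕ-≢ λ y≡ιx → ιy∉ (here (trans (cong ι y≡ιx) (ι-involutive x)))))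
      where open import Function using (_∘′_)

  leadersOf : List (Fin n)
  leadersOf = filter (λ x → x <? ι x) (allFin n)

  leaderSwaps : List (ℕ × ℕ)
  leaderSwaps = swapsOf leadersOf

  leaderSwaps-acts : ∀ y → applySwaps leaderSwaps (toℕ y) ≡ toℕ (ι y)
  leaderSwaps-acts y with Finₚ.<-cmp y (ι y)
  ... | tri< y<ιy _ _ = proj₁ cycles y (inj₁ (∈-filter⁺ (λ x → x <? ι x) (∈-allFin y) y<ιy))
    where cycles = swapsOf-cycles leadersOf (Unique.filter⁺ _ (Unique.allFin⁺ n)) (all-filter _ (allFin n))
  ... | tri> _ _ ιy<y = proj₁ cycles y (inj₂ (∈-filter⁺ (λ x → x <? ι x) (∈-allFin (ι y)) (subst (ι y Fin.<_) (sym (ι-involutive y)) ιy<y)))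
    where cycles = swapsOf-cycles leadersOf (Unique.filter⁺ _ (Unique.allFin⁺ n)) (all-filter _ (allFin n))
  ... | tri≈ _ y≡ιy _ = trans (proj₂ cycles y (not-leader y≡ιy) (not-leader (trans (sym y≡ιy) (sym (ι-involutive y))))) (cong toℕ y≡ιy)
    where
    cycles = swapsOf-cycles leadersOf (Unique.filter⁺ _ (Unique.allFin⁺ n)) (all-filter _ (allFin n))
    not-leader : ∀ {z} → z ≡ ι z → z ∉ leadersOf
    not-leader z≡ιz z∈ = <-irrefl (cong toℕ z≡ιz) (proj₂ (∈-filter⁻ (λ x → x <? ι x) {xs = allFin n} z∈))

  leaderSwaps-beyond : ∀ k → n ≤ k → applySwaps leaderSwaps k ≡ k
  leaderSwaps-beyond = swapsOf-beyond leadersOf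

  leaderSwaps-valid : ∀ {K} → n ≤ K → ValidSwaps K leaderSwaps
  leaderSwaps-valid {K} n≤K = valid leadersOf (all-filter _ (allFin n))
    where
    valid : ∀ xs → All Leader xs → ValidSwaps K (swapsOf xs)
    valid []       []                = []
    valid (x ∷ xs) (x-leads ∷ leads) =
      ((λ e → <-irrefl e x-leads) , <-≤-trans (toℕ<n x) n≤K , <-≤-trans (toℕ<n (ι x)) n≤K) ∷ valid xs leads

sorted-injective : {m n : ℕ} → CellInjective (sorted m n)
sorted-injective i i′ j j′ e =
  Linearisation.cell-injective i j i′ j′ (Data.Nat.Properties.suc-injective (trans (sym (sorted-combine i j)) (trans e (sorted-combine i′ j′))))

module TopParity (k n′ : ℕ) (ι₁ ι₂ : Fin (suc n′) → Fin (suc n′))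
                 (ι₁-involutive : ∀ y → ι₁ (ι₁ y) ≡ y) (ι₂-involutive : ∀ y → ι₂ (ι₂ y) ≡ y) where
  open Schedule ι₁ ι₂ ι₁-involutive ι₂-involutive using (entries; tag)
  open Linearisation {2 + k} {suc n′}
  open Moves (suc k) n′ using ()
  private
    module C₁ = CycleSwaps ι₁ ι₁-involutive
    module C₂ = CycleSwaps ι₂ ι₂-involutive
    M N : ℕ
    M = 2 + k
    N = suc n′
    S = sorted M N
    swaps = C₂.leaderSwaps ++ C₁.leaderSwaps
    n≤mn : N ≤ M * N
    n≤mn = m≤m+n N (suc k * N)

  module _ {A : Config M N} (body : ∀ x j → A (suc x) j ≡ S (suc x) j) (top : ∀ q → A zero (ι₁ (ι₂ q)) ≡ S zero q) where

    lin-top : ∀ k → k < M * N → lin A k ≡ lin S (applySwaps swaps k)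
    lin-top = by-cells {lin A} {λ k → lin S (applySwaps swaps k)} on-cell
      where
      cell-top : ∀ j → cell zero j ≡ toℕ j
      cell-top j = trans (cell≡ zero j) (cong (_+ toℕ j) (*-zeroʳ N))
      on-cell : ∀ i j → lin A (cell i j) ≡ lin S (applySwaps swaps (cell i j))
      on-cell zero j = begin
        lin A (cell zero j)                                 ≡⟨ lin-cell A zero j ⟩
        A zero j                                            ≡⟨ cong (A zero) (unwind j) ⟨
        A zero (ι₁ (ι₂ (ι₂ (ι₁ j))))                        ≡⟨ top (ι₂ (ι₁ j)) ⟩
        S zero (ι₂ (ι₁ j))                                  ≡⟨ lin-cell S zero (ι₂ (ι₁ j)) ⟨
        lin S (cell zero (ι₂ (ι₁ j)))                       ≡⟨ cong (lin S) (cell-top (ι₂ (ι₁ j))) ⟩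
        lin S (toℕ (ι₂ (ι₁ j)))                             ≡⟨ cong (lin S) (C₂.leaderSwaps-acts (ι₁ j)) ⟨
        lin S (applySwaps C₂.leaderSwaps (toℕ (ι₁ j)))      ≡⟨ cong (λ x → lin S (applySwaps C₂.leaderSwaps x)) (C₁.leaderSwaps-acts j) ⟨
        lin S (applySwaps C₂.leaderSwaps (applySwaps C₁.leaderSwaps (toℕ j)))
                                                            ≡⟨ cong (lin S) (applySwaps-++ C₂.leaderSwaps C₁.leaderSwaps (toℕ j)) ⟨
        lin S (applySwaps swaps (toℕ j))                    ≡⟨ cong (λ x → lin S (applySwaps swaps x)) (cell-top j) ⟨
        lin S (applySwaps swaps (cell zero j))              ∎
        where
        open ≡-Reasoning
        unwind : ∀ j → ι₁ (ι₂ (ι₂ (ι₁ j))) ≡ j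
        unwind j = trans (cong ι₁ (ι₂-involutive (ι₁ j))) (ι₁-involutive j)
      on-cell (suc x) j = begin
        lin A (cell (suc x) j)                              ≡⟨ lin-cell A (suc x) j ⟩
        A (suc x) j                                         ≡⟨ body x j ⟩
        S (suc x) j                                         ≡⟨ lin-cell S (suc x) j ⟨
        lin S (cell (suc x) j)                              ≡⟨ cong (lin S) fixed ⟨
        lin S (applySwaps swaps (cell (suc x) j))           ∎
        where
        open ≡-Reasoning
        below : N ≤ cell (suc x) j
        below = ≤-trans (m≤m+n N (N * toℕ x))
                        (≤-trans (≤-reflexive (sym (*-suc N (toℕ x))))
                                 (≤-trans (m≤m+n _ (toℕ j)) (≤-reflexive (sym (cell≡ (suc x) j)))))
        fixed : applySwaps swaps (cell (suc x) j) ≡ cell (suc x) j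
        fixed = trans (applySwaps-++ C₂.leaderSwaps C₁.leaderSwaps _)
                      (trans (cong (applySwaps C₂.leaderSwaps) (C₁.leaderSwaps-beyond _ below)) (C₂.leaderSwaps-beyond _ below))

    sign-top : sign A ≡ parity (length entries)
    sign-top = begin
      sign A                                                      ≡⟨ cong parity (inversions-cong (M * N) {lin A} {λ k → lin S (applySwaps swaps k)} lin-top) ⟩
      parity (inversions (M * N) (λ k → lin S (applySwaps swaps k)))
                                                                  ≡⟨ swaps-parity (M * N) swaps (lin S) valid (lin-injective sorted-injective) ⟩
      sign S xor parity (length swaps)                            ≡⟨ cong (_xor parity (length swaps)) sign-sorted ⟩
      parity (length swaps)                                       ≡⟨ cong parity count ⟩
      parity (length entries)                                     ∎
      where
      open ≡-Reasoning
      valid : ValidSwaps (M * N) swaps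
      valid = ++⁺ (C₂.leaderSwaps-valid n≤mn) (C₁.leaderSwaps-valid n≤mn)
      count : length swaps ≡ length entries
      count = begin
        length swaps                                              ≡⟨ length-++ C₂.leaderSwaps ⟩
        length C₂.leaderSwaps + length C₁.leaderSwaps             ≡⟨ cong₂ _+_ (length-map _ C₂.leadersOf) (length-map _ C₁.leadersOf) ⟩
        length C₂.leadersOf + length C₁.leadersOf                 ≡⟨ +-comm (length C₂.leadersOf) _ ⟩
        length C₁.leadersOf + length C₂.leadersOf                 ≡⟨ cong₂ _+_ (length-map (tag false) C₁.leadersOf) (length-map (tag true) C₂.leadersOf) ⟨
        length (map (tag false) C₁.leadersOf) + length (map (tag true) C₂.leadersOf)
                                                                  ≡⟨ length-++ (map (tag false) C₁.leadersOf) ⟨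
        length entries                                            ∎

    even-entries : sign A ≡ false → ∃[ h ] (length entries ≡ double h)
    even-entries even = parity-even (length entries) (trans (sym sign-top) even)

-- Each block D₀ R₀ D₀ R₀ⁿ⁻¹ moves the entries of the cycle formed by the top-right corner
-- and column 0 two steps down that cycle; as the cycle has odd length 1 + m, m/2 blocks
-- followed by D₀ restore column 0 and exchange the two ends of the top row.
module Gadget (h b : ℕ) where

  private
    M N : ℕ
    M = 2 + double h
    N = 2 + b
    last : Fin N
    last = fromℕ (suc b)
    D₀ R₀ : Move M N
    D₀ = rotD zero
    R₀ = rotR zero

  block : List (Move M N)
  block = D₀ ∷ R₀ ∷ D₀ ∷ replicate (suc b) R₀

  corner : Config M N → Fin (suc M) → ℕ
  corner C zero    = C zero last
  corner C (suc i) = C i zero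

  module Block (C : Config M N) where
    private
      C₁ C₂ C₃ : Config M N
      C₁ = apply D₀ C
      C₂ = apply R₀ C₁
      C₃ = apply D₀ C₂
      back : Fin N → Fin N
      back j = prev^ (suc b) j
      prev-back : ∀ j → prev (back j) ≡ j
      prev-back j = prev^-period j

    top : ∀ j → applyAll block C zero j ≡ C₃ zero (back j)
    top j = rotR^-self (suc b) C₃ zero j

    below : ∀ x j → applyAll block C (suc x) j ≡ C₃ (suc x) j
    below x j = rotR^-other (suc b) C₃ zero (suc x) j (λ ())

    back-first : back zero ≡ suc zero
    back-first = prev-injective (prev-back zero)

    back-last : back last ≡ zero
    back-last = prev-injective (prev-back last)

    top-last : applyAll block C zero last ≡ C (prev (prev zero)) zero
    top-last = begin
      applyAll block C zero last     ≡⟨ top last ⟩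
      C₃ zero (back last)            ≡⟨ cong (C₃ zero) back-last ⟩
      C₃ zero zero                   ≡⟨ rotD-self C₂ zero zero ⟩
      C₂ (prev zero) zero            ≡⟨ rotR-other C₁ zero (prev zero) zero (λ ()) ⟩
      C₁ (prev zero) zero            ≡⟨ rotD-self C (prev zero) zero ⟩
      C (prev (prev zero)) zero      ∎
      where open ≡-Reasoning

    top-first : applyAll block C zero zero ≡ C (prev zero) zero
    top-first = begin
      applyAll block C zero zero     ≡⟨ top zero ⟩
      C₃ zero (back zero)            ≡⟨ cong (C₃ zero) back-first ⟩
      C₃ zero (suc zero)             ≡⟨ rotD-other C₂ zero zero (suc zero) (λ ()) ⟩
      C₂ zero (suc zero)             ≡⟨ rotR-self C₁ zero (suc zero) ⟩
      C₁ zero zero                   ≡⟨ rotD-self C zero zero ⟩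
      C (prev zero) zero             ∎
      where open ≡-Reasoning

    column-first : applyAll block C (suc zero) zero ≡ C zero last
    column-first = begin
      applyAll block C (suc zero) zero  ≡⟨ below zero zero ⟩
      C₃ (suc zero) zero                ≡⟨ rotD-self C₂ (suc zero) zero ⟩
      C₂ zero zero                      ≡⟨ rotR-self C₁ zero zero ⟩
      C₁ zero last                      ≡⟨ rotD-other C zero zero last (λ ()) ⟩
      C zero last                       ∎
      where open ≡-Reasoning

    column-rest : ∀ y → applyAll block C (suc (suc y)) zero ≡ C (prev (prev (suc (suc y)))) zero
    column-rest y = begin
      applyAll block C (suc (suc y)) zero  ≡⟨ below (suc y) zero ⟩
      C₃ (suc (suc y)) zero                ≡⟨ rotD-self C₂ (suc (suc y)) zero ⟩
      C₂ (suc (inject₁ y)) zero            ≡⟨ rotR-other C₁ zero (suc (inject₁ y)) zero (λ ()) ⟩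
      C₁ (suc (inject₁ y)) zero            ≡⟨ rotD-self C (suc (inject₁ y)) zero ⟩
      C (inject₁ (inject₁ y)) zero         ∎
      where open ≡-Reasoning

    top-other : ∀ {j} → j ≢ zero → j ≢ last → applyAll block C zero j ≡ C zero j
    top-other {j} j≢0 j≢last = begin
      applyAll block C zero j        ≡⟨ top j ⟩
      C₃ zero (back j)               ≡⟨ rotD-other C₂ zero zero (back j) (λ 0≡back → j≢last (trans (sym (prev-back j)) (cong prev (sym 0≡back)))) ⟩
      C₂ zero (back j)               ≡⟨ rotR-self C₁ zero (back j) ⟩
      C₁ zero (prev (back j))        ≡⟨ cong (C₁ zero) (prev-back j) ⟩
      C₁ zero j                      ≡⟨ rotD-other C zero zero j (λ 0≡j → j≢0 (sym 0≡j)) ⟩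
      C zero j                       ∎
      where open ≡-Reasoning

    other : ∀ x {j} → j ≢ zero → applyAll block C (suc x) j ≡ C (suc x) j
    other x {j} j≢0 = begin
      applyAll block C (suc x) j     ≡⟨ below x j ⟩
      C₃ (suc x) j                   ≡⟨ rotD-other C₂ zero (suc x) j (λ 0≡j → j≢0 (sym 0≡j)) ⟩
      C₂ (suc x) j                   ≡⟨ rotR-other C₁ zero (suc x) j (λ ()) ⟩
      C₁ (suc x) j                   ≡⟨ rotD-other C zero (suc x) j (λ 0≡j → j≢0 (sym 0≡j)) ⟩
      C (suc x) j                    ∎
      where open ≡-Reasoning

    corner-block : ∀ x → corner (applyAll block C) x ≡ corner C (prev (prev x))
    corner-block zero                = top-last
    corner-block (suc zero)          = top-first
    corner-block (suc (suc zero))    = column-first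
    corner-block (suc (suc (suc y))) = column-rest y

  blocks : ℕ → List (Move M N)
  blocks t = concat (replicate t block)

  private
    blocks-suc : ∀ t C → applyAll (blocks (suc t)) C ≡ applyAll (blocks t) (applyAll block C)
    blocks-suc t C = applyAll-++ block (blocks t) C

  corner-blocks : ∀ t C x → corner (applyAll (blocks t) C) x ≡ corner C (prev^ (double t) x)
  corner-blocks zero    C x = refl
  corner-blocks (suc t) C x = begin
    corner (applyAll (blocks (suc t)) C) x                ≡⟨ cong (λ D → corner D x) (blocks-suc t C) ⟩
    corner (applyAll (blocks t) (applyAll block C)) x     ≡⟨ corner-blocks t (applyAll block C) x ⟩
    corner (applyAll block C) (prev^ (double t) x)        ≡⟨ Block.corner-block C (prev^ (double t) x) ⟩
    corner C (prev^ (double (suc t)) x)                   ∎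
    where open ≡-Reasoning

  top-blocks : ∀ t C {j} → j ≢ zero → j ≢ last → applyAll (blocks t) C zero j ≡ C zero j
  top-blocks zero    C j≢0 j≢last = refl
  top-blocks (suc t) C j≢0 j≢last =
    trans (cong (λ D → D zero _) (blocks-suc t C)) (trans (top-blocks t _ j≢0 j≢last) (Block.top-other C j≢0 j≢last))

  other-blocks : ∀ t C x {j} → j ≢ zero → applyAll (blocks t) C (suc x) j ≡ C (suc x) j
  other-blocks zero    C x j≢0 = refl
  other-blocks (suc t) C x j≢0 =
    trans (cong (λ D → D (suc x) _) (blocks-suc t C)) (trans (other-blocks t _ x j≢0) (Block.other C x j≢0))

  gadget : List (Move M N)
  gadget = blocks (suc h) ++ D₀ ∷ []

  module Effect (C : Config M N) where
    private
      B : Config M N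
      B = applyAll (blocks (suc h)) C
      G≡ : applyAll gadget C ≡ apply D₀ B
      G≡ = applyAll-++ (blocks (suc h)) (D₀ ∷ []) C
      -- after m/2 blocks every entry of the cycle has moved m = -1 steps
      undone : ∀ {y z : Fin (suc M)} → prev z ≡ y → prev^ M y ≡ z
      undone {y} e = prev-injective (trans (prev^-period y) (sym e))
      corner-B : ∀ {y z : Fin (suc M)} → prev z ≡ y → corner B y ≡ corner C z
      corner-B {y} {z} e = trans (corner-blocks (suc h) C y) (cong (corner C) (undone {y} {z} e))

    gadget-first : applyAll gadget C zero zero ≡ C zero last
    gadget-first rewrite G≡ = trans (rotD-self B zero zero) (corner-B {suc (prev zero)} {zero} refl)

    gadget-last : applyAll gadget C zero last ≡ C zero zero
    gadget-last rewrite G≡ = trans (rotD-other B zero zero last (λ ())) (corner-B {zero} {suc zero} refl)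

    gadget-column : ∀ x → applyAll gadget C (suc x) zero ≡ C (suc x) zero
    gadget-column x rewrite G≡ = trans (rotD-self B (suc x) zero) (corner-B {suc (inject₁ x)} {suc (suc x)} refl)

    gadget-top : ∀ {j} → j ≢ zero → j ≢ last → applyAll gadget C zero j ≡ C zero j
    gadget-top {j} j≢0 j≢last rewrite G≡ =
      trans (rotD-other B zero zero j (λ 0≡j → j≢0 (sym 0≡j))) (top-blocks (suc h) C j≢0 j≢last)

    gadget-other : ∀ x {j} → j ≢ zero → applyAll gadget C (suc x) j ≡ C (suc x) j
    gadget-other x {j} j≢0 rewrite G≡ =
      trans (rotD-other B zero (suc x) j (λ 0≡j → j≢0 (sym 0≡j))) (other-blocks (suc h) C x j≢0)

  gadget-RD : All IsRDMove gadget
  gadget-RD = ++⁺ (concat⁺ (replicate⁺ (suc h) (isD zero ∷ isR zero ∷ isD zero ∷ replicate⁺ (suc b) (isR zero)))) (isD zero ∷ [])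

  gadget-length : length gadget ≤ 2 * (M * N)
  gadget-length = begin
    length gadget                            ≡⟨ length-++ (blocks (suc h)) ⟩
    length (blocks (suc h)) + 1              ≤⟨ +-mono-≤ (blocks-length (suc h)) (s≤s z≤n) ⟩
    suc h * (N + N) + M * N                  ≡⟨ cong (_+ M * N) (double-* (suc h) N) ⟨
    M * N + M * N                            ≡⟨ cong (M * N +_) (+-identityʳ (M * N)) ⟨
    2 * (M * N)                              ∎
    where
    open ≤-Reasoning
    double-* : ∀ t N → double t * N ≡ t * (N + N)
    double-* zero    N = refl
    double-* (suc t) N = trans (cong (λ x → N + (N + x)) (double-* t N)) (+-assoc N N (t * (N + N)) |> sym)
    blocks-length : ∀ t → length (blocks t) ≤ t * (N + N)
    blocks-length zero    = z≤n
    blocks-length (suc t) = begin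
      length (block ++ blocks t)             ≡⟨ length-++ block ⟩
      length block + length (blocks t)       ≡⟨ cong (λ l → 3 + l + length (blocks t)) (length-replicate (suc b)) ⟩
      (2 + N) + length (blocks t)            ≤⟨ +-mono-≤ (+-monoˡ-≤ N (s≤s (s≤s z≤n))) (blocks-length t) ⟩
      (N + N) + t * (N + N)                  ∎

  module _ (C : Config M N) where
    open Linearisation {M} {N}
    open Effect C

    private
      cell-top : ∀ j → cell zero j ≡ toℕ j
      cell-top j = trans (cell≡ zero j) (cong (_+ toℕ j) (*-zeroʳ N))
      n≤cell : ∀ x j → N ≤ cell (suc x) j
      n≤cell x j = ≤-trans (m≤m+n N (N * toℕ x))
                     (≤-trans (≤-reflexive (sym (*-suc N (toℕ x)))) (≤-trans (m≤m+n _ (toℕ j)) (≤-reflexive (sym (cell≡ (suc x) j)))))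
      far : ∀ x j → cell (suc x) j ≢ 0 × cell (suc x) j ≢ suc b
      far x j = (λ e → contradiction (subst (N ≤_) e (n≤cell x j)) λ ())
              , (λ e → <-irrefl refl (subst (N ≤_) e (n≤cell x j)))

    lin-gadget : ∀ k → k < M * N → lin (applyAll gadget C) k ≡ lin C (swap 0 (suc b) k)
    lin-gadget = by-cells {lin (applyAll gadget C)} {λ k → lin C (swap 0 (suc b) k)} on-cell
      where
      on-cell : ∀ i j → lin (applyAll gadget C) (cell i j) ≡ lin C (swap 0 (suc b) (cell i j))
      on-cell zero j with j ≟ zero | j ≟ last
      ... | yes refl | _ = begin
        lin (applyAll gadget C) (cell zero zero)       ≡⟨ lin-cell (applyAll gadget C) zero zero ⟩
        applyAll gadget C zero zero                    ≡⟨ gadget-first ⟩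
        C zero last                                    ≡⟨ lin-cell C zero last ⟨
        lin C (cell zero last)                         ≡⟨ cong (lin C) (trans (cell-top last) (toℕ-fromℕ (suc b))) ⟩
        lin C (suc b)                                  ≡⟨ cong (lin C) (trans (cong (swap 0 (suc b)) (cell-top zero)) (swap-fst 0 (suc b))) ⟨
        lin C (swap 0 (suc b) (cell zero zero))        ∎
        where open ≡-Reasoning
      ... | no j≢0 | yes refl = begin
        lin (applyAll gadget C) (cell zero last)       ≡⟨ lin-cell (applyAll gadget C) zero last ⟩
        applyAll gadget C zero last                    ≡⟨ gadget-last ⟩
        C zero zero                                    ≡⟨ lin-cell C zero zero ⟨
        lin C (cell zero zero)                         ≡⟨ cong (lin C) (cell-top zero) ⟩
        lin C 0                                        ≡⟨ cong (lin C) (trans (cong (swap 0 (suc b)) (trans (cell-top last) (toℕ-fromℕ (suc b)))) (swap-snd 0 (suc b))) ⟨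
        lin C (swap 0 (suc b) (cell zero last))        ∎
        where open ≡-Reasoning
      ... | no j≢0 | no j≢last = begin
        lin (applyAll gadget C) (cell zero j)          ≡⟨ lin-cell (applyAll gadget C) zero j ⟩
        applyAll gadget C zero j                       ≡⟨ gadget-top j≢0 j≢last ⟩
        C zero j                                       ≡⟨ lin-cell C zero j ⟨
        lin C (cell zero j)                            ≡⟨ cong (lin C) (swap-other 0 (suc b) (j≢0 ∘′ toℕ-injective ∘′ trans (sym (cell-top j)))
                                                                           (j≢last ∘′ toℕ-injective ∘′ λ e → trans (sym (cell-top j)) (trans e (sym (toℕ-fromℕ (suc b)))))) ⟨
        lin C (swap 0 (suc b) (cell zero j))           ∎
        where open ≡-Reasoning
      on-cell (suc x) j = begin
        lin (applyAll gadget C) (cell (suc x) j)       ≡⟨ lin-cell (applyAll gadget C) (suc x) j ⟩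
        applyAll gadget C (suc x) j                    ≡⟨ unchanged (j ≟ zero) ⟩
        C (suc x) j                                    ≡⟨ lin-cell C (suc x) j ⟨
        lin C (cell (suc x) j)                         ≡⟨ cong (lin C) (swap-other 0 (suc b) (proj₁ (far x j)) (proj₂ (far x j))) ⟨
        lin C (swap 0 (suc b) (cell (suc x) j))        ∎
        where
        open ≡-Reasoning
        unchanged : Dec (j ≡ zero) → applyAll gadget C (suc x) j ≡ C (suc x) j
        unchanged (yes refl) = gadget-column x
        unchanged (no j≢0)   = gadget-other x j≢0

    sign-gadget : CellInjective C → sign (applyAll gadget C) ≡ not (sign C)
    sign-gadget C-injective =
      trans (cong parity (inversions-cong (M * N) {lin (applyAll gadget C)} {λ k → lin C (swap 0 (suc b) k)} lin-gadget))
            (swap-flips (M * N) (lin C) (λ ()) (≤-trans (s≤s z≤n) (cell-< zero last))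
                        (subst (_< M * N) (trans (cell-top last) (toℕ-fromℕ (suc b))) (cell-< zero last)) (lin-injective C-injective))

BodySorted′ : {m n : ℕ} → Config (suc m) n → Set
BodySorted′ {m} {n} C = ∀ x j → C (suc x) j ≡ sorted (suc m) n (suc x) j

sort-even : ∀ k b (A : Config (2 + k) (2 + b)) → IsInstance (2 + k) (2 + b) A → BodySorted′ A →
            Linearisation.sign A ≡ false →
            ∃[ ms ] (All IsRDMove ms × length ms ≤ 12 * ((2 + k) * (2 + b)) × (∀ i j → applyAll ms A i j ≡ sorted (2 + k) (2 + b) i j))
sort-even k b A inst body even-sign = sortMoves , sortMoves-RD , sortMoves-length , sorts
  where
  π = TopRow.top-permutation A inst body
  factors = involution-factorisation π
  ι₁ = proj₁ factors
  ι₂ = proj₁ (proj₂ factors)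
  ι₁-involutive = proj₁ (proj₂ (proj₂ factors))
  ι₂-involutive = proj₁ (proj₂ (proj₂ (proj₂ factors)))
  top : ∀ q → A zero (ι₁ (ι₂ q)) ≡ sorted (2 + k) (2 + b) zero q
  top q = trans (cong (A zero) (sym (proj₂ (proj₂ (proj₂ (proj₂ factors))) q))) (TopRow.top-permutation-sorts A inst body q)
  open Sorting k ι₁ ι₂ ι₁-involutive ι₂-involutive
  even-entries = TopParity.even-entries k (suc b) ι₁ ι₂ ι₁-involutive ι₂-involutive body top even-sign
  sorts : ∀ i j → applyAll sortMoves A i j ≡ sorted (2 + k) (2 + b) i j
  sorts zero    j = trans (sort-top (proj₂ even-entries) body j) (top j)
  sorts (suc x) j = sort-body (proj₂ even-entries) body x j

EvenAfter : ∀ k b → Config (2 + k) (2 + b) → List (Move (2 + k) (2 + b)) → Set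
EvenAfter k b A fix = All IsRDMove fix × length fix ≤ 2 * ((2 + k) * (2 + b))
                    × IsInstance (2 + k) (2 + b) (applyAll fix A) × BodySorted′ (applyAll fix A)
                    × Linearisation.sign (applyAll fix A) ≡ false

fix-parity : ∀ k b (A : Config (2 + k) (2 + b)) → IsInstance (2 + k) (2 + b) A → Sortable (2 + k) (2 + b) A →
             BodySorted′ A → ∃[ fix ] EvenAfter k b A fix
fix-parity k b A inst sortable body with Linearisation.sign A in sign≡
... | false = [] , [] , z≤n , inst , body , sign≡
... | true with parity (suc b) in n′-odd
...   | true = rotR zero ∷ [] , isR zero ∷ [] , ≤-trans (s≤s z≤n) (m≤m+n ((2 + k) * (2 + b)) _) , Moves.apply-instance (suc k) (suc b) (rotR zero) inst ,
               (λ x j → trans (rotR-other A zero (suc x) j (λ ())) (body x j)) ,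
               trans (Moves.sign-apply (suc k) (suc b) (rotR zero) (proj₂ inst)) (cong₂ _xor_ sign≡ n′-odd)
...   | false with parity (suc k) in m′-odd
...     | false = contradiction (trans (sym sign≡) (Moves.sortable⇒even (suc k) (suc b) m′-odd n′-odd (proj₂ inst) sortable)) λ ()
...     | true with parity-even k (trans (sym (not-involutive (parity k))) (cong not m′-odd))
...       | h , refl = gadget , gadget-RD , gadget-length , Moves.applyAll-instance (suc k) (suc b) gadget inst ,
                       (λ x j → trans (column-or-other x j) (body x j)) ,
                       trans (sign-gadget A (proj₂ inst)) (cong not sign≡)
  where
  open Gadget h b
  open Effect A
  column-or-other : ∀ x j → applyAll gadget A (suc x) j ≡ A (suc x) j
  column-or-other x zero    = gadget-column x
  column-or-other x (suc j) = gadget-other x λ ()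

lemma11 : ∃[ c ] ((c > 0) × ((m n : ℕ) → 2 ≤ m → 2 ≤ n → (A : Config m n) → IsInstance m n A
            → Sortable m n A → ((j : Fin n) → BodySorted m n A j)
            → ∃[ ms ] (All IsRDMove ms × (length ms ≤ c * (m * n))
              × ((i : Fin m) (j : Fin n) → applyAll ms A i j ≡ sorted m n i j))))
lemma11 = 14 , s≤s z≤n , λ { (suc (suc k)) (suc (suc b)) (s≤s (s≤s _)) (s≤s (s≤s _)) A inst sortable body-sorted → solve k b A inst sortable (λ x j → body-sorted j x) }
  where
  solve : ∀ k b (A : Config (2 + k) (2 + b)) → IsInstance _ _ A → Sortable _ _ A → BodySorted′ A →
          ∃[ ms ] (All IsRDMove ms × (length ms ≤ 14 * ((2 + k) * (2 + b))) × (∀ i j → applyAll ms A i j ≡ sorted _ _ i j))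
  solve k b A inst sortable body =
    let fix , fix-RD , fix-length , inst′ , body′ , even = fix-parity k b A inst sortable body
        ms , ms-RD , ms-length , sorts = sort-even k b (applyAll fix A) inst′ body′ even
    in fix ++ ms , ++⁺ fix-RD ms-RD
     , ≤-trans (≤-reflexive (length-++ fix)) (≤-trans (+-mono-≤ fix-length ms-length) (≤-reflexive (sym (*-distribʳ-+ ((2 + k) * (2 + b)) 2 12))))
     , λ i j → trans (cong (λ C → C i j) (applyAll-++ fix ms A)) (sorts i j)
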